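{- Let $0\le l<n$. For every nonempty $S=\{r_1<\cdots<r_d\}\subseteq[n-l]$, the flag $f$-vector of $R_{n,l}$ satisfies $$\alpha_S=\binom{l+r_1-1}{l}\binom{n}{l+r_d}\binom{2l+r_d}{r_d-r_1}\binom{r_d-r_1}{r_2-r_1,\dots,r_d-r_{d-1}}.$$
   Context: $R_{n,l}$ is the poset whose elements are $(l+1)$-tuples $(A_1,\dots,A_{l+1})$ of nonempty subsets of $[n]=\{1,\dots,n\}$ with $\max(A_i)<\min(A_{i+1})$ for all $i\in[l]$, ordered by componentwise containment. It is graded, with ranks labeled $1$ to $n-l$: the rank of $(A_1,\dots,A_{l+1})$ is $|A_1\cup\cdots\cup A_{l+1}|-l$. For $S\subseteq[n-l]$, $\alpha_S$ is the number of chains of $R_{n,l}$ whose set of ranks is exactly $S$. The last factor is a multinomial coefficient (equal to $1$ when $d=1$). -}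

module Defs where

open import Data.Bool using (Bool; true; false; _∧_; _∨_; not)
open import Data.Nat using (ℕ; zero; suc; _+_; _*_; _∸_; _<ᵇ_; _≡ᵇ_; _!; NonZero)
open import Data.Nat.Properties using (_!≢0; m*n≢0)
open import Data.Nat.DivMod using (_/_)
open import Data.Fin using (Fin; toℕ)
open import Data.Fin.Subset using (Subset; ⋃; ∣_∣; inside; outside)
open import Data.Vec using (Vec; []; _∷_; toList; lookup)
open import Data.List using (List; []; _∷_; [_]; map; _++_; concatMap; filterᵇ; length; allFin)
open import Data.Bool.ListAction using (and; or)
open import Data.Nat.ListAction using (sum; product)

-- Convention: Subset n = Vec Bool n; the position i : Fin n stands for the
-- element (toℕ i + 1) of [n] = {1,…,n}, so the order on Fin n is the order on [n].

allSubsets : (n : ℕ) → List (Subset n)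
allSubsets zero    = [ [] ]
allSubsets (suc n) = map (outside ∷_) (allSubsets n) ++ map (inside ∷_) (allSubsets n)

allVecs : {A : Set} → List A → (k : ℕ) → List (Vec A k)
allVecs xs zero    = [ [] ]
allVecs xs (suc k) = concatMap (λ x → map (x ∷_) (allVecs xs k)) xs

allB : {n : ℕ} → (Fin n → Bool) → Bool
allB {n} f = and (map f (allFin n))

anyB : {n : ℕ} → (Fin n → Bool) → Bool
anyB {n} f = or (map f (allFin n))

nonemptyB : {n : ℕ} → Subset n → Bool
nonemptyB p = anyB (lookup p)

subsetB : {n : ℕ} → Subset n → Subset n → Bool
subsetB p q = allB (λ i → not (lookup p i) ∨ lookup q i)

-- every element of A is smaller than every element of B
-- (for nonempty A, B this is exactly max A < min B)
beforeB : {n : ℕ} → Subset n → Subset n → Bool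
beforeB p q = allB (λ i → allB (λ j → not (lookup p i ∧ lookup q j) ∨ (toℕ i <ᵇ toℕ j)))

consecBeforeB : {n k : ℕ} → Vec (Subset n) k → Bool
consecBeforeB []               = true
consecBeforeB (a ∷ [])         = true
consecBeforeB (a ∷ (b ∷ rest)) = beforeB a b ∧ consecBeforeB (b ∷ rest)

allNonemptyB : {n k : ℕ} → Vec (Subset n) k → Bool
allNonemptyB []       = true
allNonemptyB (a ∷ as) = nonemptyB a ∧ allNonemptyB as

Tuple : ℕ → ℕ → Set
Tuple n l = Vec (Subset n) (suc l)

isElemB : {n l : ℕ} → Tuple n l → Bool
isElemB x = allNonemptyB x ∧ consecBeforeB x

elementsR : (n l : ℕ) → List (Tuple n l)
elementsR n l = filterᵇ isElemB (allVecs (allSubsets n) (suc l))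

rankR : {n : ℕ} (l : ℕ) → Tuple n l → ℕ
rankR l x = ∣ ⋃ (toList x) ∣ ∸ l

leqB : {n k : ℕ} → Vec (Subset n) k → Vec (Subset n) k → Bool
leqB []       []       = true
leqB (a ∷ as) (b ∷ bs) = subsetB a b ∧ leqB as bs

increasingB : {n l : ℕ} → List (Tuple n l) → Bool
increasingB []               = true
increasingB (x ∷ [])         = true
increasingB (x ∷ (y ∷ rest)) = leqB x y ∧ increasingB (y ∷ rest)

rankedSeqs : (n l : ℕ) → List ℕ → List (List (Tuple n l))
rankedSeqs n l []       = [ [] ]
rankedSeqs n l (r ∷ rs) =
  concatMap (λ x → map (x ∷_) (rankedSeqs n l rs))
            (filterᵇ (λ x → rankR l x ≡ᵇ r) (elementsR n l))

-- For S = {r_1 < ⋯ < r_d} given as the increasing list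
-- (r_1 ∷ ⋯ ∷ r_d), a chain of R_{n,l} with rank set exactly S is the same as a
-- sequence x_1 < ⋯ < x_d of elements with rank x_j = r_j (listing the chain in
-- increasing order); since the ranks are distinct, x_j ≤ x_{j+1} is equivalent
-- to x_j < x_{j+1}.  alpha n l S counts these.
alpha : (n l : ℕ) → List ℕ → ℕ
alpha n l S = length (filterᵇ increasingB (rankedSeqs n l S))

lastOf : ℕ → List ℕ → ℕ
lastOf r []       = r
lastOf r (s ∷ ss) = lastOf s ss

gaps : ℕ → List ℕ → List ℕ
gaps r []       = []
gaps r (s ∷ ss) = (s ∸ r) ∷ gaps s ss

prodFact≢0 : (ks : List ℕ) → NonZero (product (map _! ks))
prodFact≢0 []       = _
prodFact≢0 (k ∷ ks) = m*n≢0 (k !) (product (map _! ks)) {{k !≢0}} {{prodFact≢0 ks}}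

multinomial : List ℕ → ℕ
multinomial ks = ((sum ks) ! / product (map _! ks)) {{prodFact≢0 ks}}

module Submission where

open import Level using (0ℓ)
open import Tactic.RingSolver using () renaming (solve-∀ to solve-∀-with)
import Tactic.RingSolver.Core.AlmostCommutativeRing as ACR

open import Defs
open import Data.Bool using (Bool; true; false; _∧_; _∨_; not; if_then_else_)
open import Data.Bool.Properties
  using (T-≡; ∨-∧-commutativeSemiring; ∧-assoc; ∨-zeroʳ; ∨-identityʳ; ∧-zeroʳ; ∧-identityʳ)
open import Data.Bool.ListAction using (and; or)
open import Data.Empty using (⊥; ⊥-elim)
open import Data.Fin using (Fin; toℕ) renaming (zero to fzero; suc to fsuc)
open import Data.Fin.Subset using (Subset; ⋃; ∣_∣; _∪_)
open import Data.List using (List; []; _∷_; [_]; map; _++_; concatMap; filterᵇ; length)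
open import Data.List.Properties using (map-tabulate)
open import Data.List.Membership.Propositional using (_∈_)
open import Data.List.Relation.Unary.All using (All; []; _∷_)
open import Data.List.Relation.Unary.Any using (here; there)
open import Data.List.Relation.Unary.Linked using (Linked; []; [-]; _∷_)
import Data.List.Relation.Unary.Linked as Linked
open import Data.List.Relation.Unary.Unique.Propositional using (Unique)
open import Data.List.Relation.Unary.AllPairs using ([]; _∷_)
open import Data.Maybe using (Maybe; just; nothing)
import Data.Maybe as Maybe
open import Data.Nat
open import Data.Nat.Properties
open import Data.Nat.Tactic.RingSolver using (solve-∀)
open import Data.Nat.Combinatorics using (_C_; nCk+nC[k+1]≡[n+1]C[k+1]; nCk≡n!/k![n-k]!; k![n∸k]!∣n!)
open import Data.Nat.DivMod using (_/_; m*n/n≡m; m/n*n≡m)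
open import Data.Nat.ListAction using (sum; product)
open import Data.Product using (∃-syntax; _×_; _,_; proj₁; proj₂)
open import Data.Sum using (_⊎_; inj₁; inj₂)
open import Data.Vec using (Vec; []; _∷_; zipWith; replicate; toList; lookup)
import Data.Vec as Vec
open import Data.Vec.Properties using (∷-injectiveˡ; ∷-injectiveʳ; ≡-dec)
import Data.List.Relation.Unary.All as All
open import Function using (id; _∘_; case_of_)
open import Function.Bundles using (Equivalence)
open import Relation.Binary.PropositionalEquality hiding ([_])
open import Relation.Binary.Definitions using (DecidableEquality)
open import Relation.Nullary using (¬_; yes; no)
open import Relation.Nullary.Decidable using (decidable-stable)

-- Read [n] from the left and count chains restricted to final segments of [n]. Restricted
-- to a final segment, an element of R_{n,l} has lost its first i blocks entirely and maybe
-- part of block i; a chain of such restrictions is recorded together with i and with the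
-- first chain position t from which block i has lost an element. A new least element is
-- either unused or joins block i, or block i + 1, from some chain position p onwards. This
-- gives a recurrence in n in which the ranks enter through the first rank and the gaps
-- between consecutive ranks; the product of binomial coefficients on the right-hand side,
-- written in these coordinates, satisfies the same recurrence by Pascal's rule and agrees
-- with the count for n = 0.

⟦_⟧ : Bool → ℕ
⟦ true ⟧  = 1
⟦ false ⟧ = 0

⟦∧⟧ : ∀ a b → ⟦ a ∧ b ⟧ ≡ ⟦ a ⟧ * ⟦ b ⟧
⟦∧⟧ true  b = sym (+-identityʳ ⟦ b ⟧)
⟦∧⟧ false b = refl

⟦⟧≢0 : ∀ {b} → ⟦ b ⟧ ≢ 0 → b ≡ true
⟦⟧≢0 {true}  _  = refl
⟦⟧≢0 {false} ne = ⊥-elim (ne refl)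

module _ {A : Set} where

  ∑ : List A → (A → ℕ) → ℕ
  ∑ []       f = 0
  ∑ (x ∷ xs) f = f x + ∑ xs f

  ∑-cong : ∀ xs {f g : A → ℕ} → (∀ x → f x ≡ g x) → ∑ xs f ≡ ∑ xs g
  ∑-cong []       e = refl
  ∑-cong (x ∷ xs) e = cong₂ _+_ (e x) (∑-cong xs e)

  ∑-cong-∈ : ∀ xs {f g : A → ℕ} → (∀ {x} → x ∈ xs → f x ≡ g x) → ∑ xs f ≡ ∑ xs g
  ∑-cong-∈ []       e = refl
  ∑-cong-∈ (x ∷ xs) e = cong₂ _+_ (e (here refl)) (∑-cong-∈ xs (e ∘ there))

  ∑-zero : ∀ xs {f : A → ℕ} → (∀ x → f x ≡ 0) → ∑ xs f ≡ 0
  ∑-zero []       e = refl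
  ∑-zero (x ∷ xs) e = cong₂ _+_ (e x) (∑-zero xs e)

  ∑-++ : ∀ xs ys (f : A → ℕ) → ∑ (xs ++ ys) f ≡ ∑ xs f + ∑ ys f
  ∑-++ []       ys f = refl
  ∑-++ (x ∷ xs) ys f = trans (cong (f x +_) (∑-++ xs ys f)) (sym (+-assoc (f x) _ _))

  ∑-+ : ∀ xs (f g : A → ℕ) → ∑ xs (λ x → f x + g x) ≡ ∑ xs f + ∑ xs g
  ∑-+ []       f g = refl
  ∑-+ (x ∷ xs) f g = trans (cong (f x + g x +_) (∑-+ xs f g)) (swap (f x) (g x) (∑ xs f) (∑ xs g))
    where
    swap : ∀ a b c d → a + b + (c + d) ≡ a + c + (b + d)
    swap = solve-∀

  ∑-*ˡ : ∀ xs k (f : A → ℕ) → ∑ xs (λ x → k * f x) ≡ k * ∑ xs f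
  ∑-*ˡ []       k f = sym (*-zeroʳ k)
  ∑-*ˡ (x ∷ xs) k f = trans (cong (k * f x +_) (∑-*ˡ xs k f)) (sym (*-distribˡ-+ k (f x) _))

  ∑-filterᵇ : ∀ (p : A → Bool) xs (f : A → ℕ) → ∑ (filterᵇ p xs) f ≡ ∑ xs (λ x → ⟦ p x ⟧ * f x)
  ∑-filterᵇ p []       f = refl
  ∑-filterᵇ p (x ∷ xs) f with p x
  ... | true  = cong₂ _+_ (sym (+-identityʳ (f x))) (∑-filterᵇ p xs f)
  ... | false = ∑-filterᵇ p xs f

  length-filterᵇ : ∀ (p : A → Bool) xs → length (filterᵇ p xs) ≡ ∑ xs (λ x → ⟦ p x ⟧)
  length-filterᵇ p []       = refl
  length-filterᵇ p (x ∷ xs) with p x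
  ... | true  = cong suc (length-filterᵇ p xs)
  ... | false = length-filterᵇ p xs

  ∑≢0⇒∃ : ∀ xs (f : A → ℕ) → ∑ xs f ≢ 0 → ∃[ x ] x ∈ xs × f x ≢ 0
  ∑≢0⇒∃ []       f ne = ⊥-elim (ne refl)
  ∑≢0⇒∃ (x ∷ xs) f ne with f x in fx
  ... | zero  = let y , y∈ , fy = ∑≢0⇒∃ xs f ne in y , there y∈ , fy
  ... | suc _ = x , here refl , λ fx≡0 → 1+n≢0 (trans (sym fx) fx≡0)

module _ {A B : Set} where

  ∑-map : ∀ (g : A → B) xs (f : B → ℕ) → ∑ (map g xs) f ≡ ∑ xs (f ∘ g)
  ∑-map g []       f = refl
  ∑-map g (x ∷ xs) f = cong (f (g x) +_) (∑-map g xs f)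

  ∑-swap : ∀ xs ys (f : A → B → ℕ) → ∑ xs (λ x → ∑ ys (f x)) ≡ ∑ ys (λ y → ∑ xs (λ x → f x y))
  ∑-swap []       ys f = sym (∑-zero ys (λ _ → refl))
  ∑-swap (x ∷ xs) ys f =
    trans (cong (∑ ys (f x) +_) (∑-swap xs ys f)) (sym (∑-+ ys (f x) (λ y → ∑ xs (λ x → f x y))))

∑-pairs : ∀ {A B D : Set} xs ys (g : A → B → D) (f : D → ℕ) →
  ∑ (concatMap (λ x → map (g x) ys) xs) f ≡ ∑ xs (λ x → ∑ ys (λ y → f (g x y)))
∑-pairs []       ys g f = refl
∑-pairs (x ∷ xs) ys g f =
  trans (∑-++ (map (g x) ys) _ f) (cong₂ _+_ (∑-map (g x) ys f) (∑-pairs xs ys g f))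

∑-⟦∧⟧ : ∀ {A : Set} xs a (f : A → Bool) →
  ∑ xs (λ x → ⟦ a ∧ f x ⟧) ≡ ⟦ a ⟧ * ∑ xs (λ x → ⟦ f x ⟧)
∑-⟦∧⟧ xs a f = trans (∑-cong xs (λ x → ⟦∧⟧ a (f x))) (∑-*ˡ xs ⟦ a ⟧ (λ x → ⟦ f x ⟧))

∑< : ℕ → (ℕ → ℕ) → ℕ
∑< zero    f = 0
∑< (suc d) f = f 0 + ∑< d (f ∘ suc)

∑<-cong : ∀ d {f g : ℕ → ℕ} → (∀ p → p < d → f p ≡ g p) → ∑< d f ≡ ∑< d g
∑<-cong zero    e = refl
∑<-cong (suc d) e = cong₂ _+_ (e 0 z<s) (∑<-cong d (λ p p<d → e (suc p) (s<s p<d)))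

∑<-*ˡ : ∀ d k f → ∑< d (λ p → k * f p) ≡ k * ∑< d f
∑<-*ˡ zero    k f = sym (*-zeroʳ k)
∑<-*ˡ (suc d) k f = trans (cong (k * f 0 +_) (∑<-*ˡ d k (f ∘ suc))) (sym (*-distribˡ-+ k (f 0) _))

∑ᵐ : {A : Set} → Maybe A → (A → ℕ) → ℕ
∑ᵐ nothing  f = 0
∑ᵐ (just x) f = f x

module _ {A : Set} where

  ∑ᵐ-map : ∀ {B : Set} (h : B → A) (m : Maybe B) (f : A → ℕ) → ∑ᵐ (Maybe.map h m) f ≡ ∑ᵐ m (f ∘ h)
  ∑ᵐ-map h nothing  f = refl
  ∑ᵐ-map h (just x) f = refl

  ∑ᵐ-cong : ∀ m {f g : A → ℕ} → (∀ x → m ≡ just x → f x ≡ g x) → ∑ᵐ m f ≡ ∑ᵐ m g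
  ∑ᵐ-cong nothing  e = refl
  ∑ᵐ-cong (just x) e = e x refl

  ∑ᵐ-*ˡ : ∀ m k (f : A → ℕ) → ∑ᵐ m (λ x → k * f x) ≡ k * ∑ᵐ m f
  ∑ᵐ-*ˡ nothing  k f = sym (*-zeroʳ k)
  ∑ᵐ-*ˡ (just x) k f = refl

-- Every element occurs in xs exactly once.
Enumerates : {A : Set} → List A → Set
Enumerates {A} xs = ∀ v (H : A → ℕ) → (∀ x → x ≢ v → H x ≡ 0) → ∑ xs H ≡ H v

module _ {A : Set} where

  ∑-support : DecidableEquality A → ∀ {xs} → Enumerates xs → ∀ {ps} → Unique ps →
    (H : A → ℕ) → (∀ x → H x ≢ 0 → x ∈ ps) → ∑ xs H ≡ ∑ ps H
  ∑-support _≟ᴬ_ {xs} enum {[]} [] H supp =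
    ∑-zero xs (λ x → decidable-stable (H x ≟ 0) (λ Hx≢0 → case supp x Hx≢0 of λ ()))
  ∑-support _≟ᴬ_ {xs} enum {p ∷ ps} (p∉ps ∷ uniq) H supp = begin
    ∑ xs H                         ≡⟨ ∑-cong xs split ⟩
    ∑ xs (λ x → Hₚ x + Hᵣ x)       ≡⟨ ∑-+ xs Hₚ Hᵣ ⟩
    ∑ xs Hₚ + ∑ xs Hᵣ              ≡⟨ cong₂ _+_ (enum p Hₚ Hₚ-point)
                                              (∑-support _≟ᴬ_ {xs} enum uniq Hᵣ Hᵣ-supp) ⟩
    Hₚ p + ∑ ps Hᵣ                 ≡⟨ cong₂ _+_ Hₚ-p (∑-cong-∈ ps Hᵣ-ps) ⟩
    H p + ∑ ps H                   ∎
    where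
    open ≡-Reasoning
    Hₚ Hᵣ : A → ℕ
    Hₚ x with x ≟ᴬ p
    ... | yes _ = H x
    ... | no _  = 0
    Hᵣ x with x ≟ᴬ p
    ... | yes _ = 0
    ... | no _  = H x
    split : ∀ x → H x ≡ Hₚ x + Hᵣ x
    split x with x ≟ᴬ p
    ... | yes _ = sym (+-identityʳ (H x))
    ... | no _  = refl
    Hₚ-point : ∀ x → x ≢ p → Hₚ x ≡ 0
    Hₚ-point x x≢p with x ≟ᴬ p
    ... | yes x≡p = ⊥-elim (x≢p x≡p)
    ... | no _    = refl
    Hₚ-p : Hₚ p ≡ H p
    Hₚ-p with p ≟ᴬ p
    ... | yes _  = refl
    ... | no p≢p = ⊥-elim (p≢p refl)
    Hᵣ-supp : ∀ x → Hᵣ x ≢ 0 → x ∈ ps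
    Hᵣ-supp x Hᵣx≢0 with x ≟ᴬ p
    ... | yes _   = ⊥-elim (Hᵣx≢0 refl)
    ... | no x≢p with supp x Hᵣx≢0
    ...   | here x≡p = ⊥-elim (x≢p x≡p)
    ...   | there x∈ps = x∈ps
    Hᵣ-ps : ∀ {x} → x ∈ ps → Hᵣ x ≡ H x
    Hᵣ-ps {x} x∈ps with x ≟ᴬ p
    ... | yes x≡p = ⊥-elim (All.lookup p∉ps x∈ps (sym x≡p))
    ... | no _    = refl

  allVecs-enumerates : ∀ {xs : List A} → Enumerates xs → ∀ k → Enumerates (allVecs xs k)
  allVecs-enumerates enum zero    [] H _ = +-identityʳ (H [])
  allVecs-enumerates {xs} enum (suc k) (a ∷ w) H off = begin
    ∑ (allVecs xs (suc k)) H                          ≡⟨ ∑-pairs xs (allVecs xs k) _∷_ H ⟩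
    ∑ xs (λ x → ∑ (allVecs xs k) (λ ws → H (x ∷ ws))) ≡⟨ enum a _ off-head ⟩
    ∑ (allVecs xs k) (λ ws → H (a ∷ ws))              ≡⟨ allVecs-enumerates enum k w _ off-tail ⟩
    H (a ∷ w)                                          ∎
    where
    open ≡-Reasoning
    off-head : ∀ x → x ≢ a → ∑ (allVecs xs k) (λ ws → H (x ∷ ws)) ≡ 0
    off-head x x≢a = ∑-zero (allVecs xs k) (λ ws → off (x ∷ ws) (x≢a ∘ ∷-injectiveˡ))
    off-tail : ∀ ws → ws ≢ w → H (a ∷ ws) ≡ 0
    off-tail ws ws≢w = off (a ∷ ws) (ws≢w ∘ ∷-injectiveʳ)

booleans : List Bool
booleans = false ∷ true ∷ []

booleans-enumerates : Enumerates booleans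
booleans-enumerates false H off = trans (cong (λ z → H false + (z + 0)) (off true (λ ()))) (+-identityʳ (H false))
booleans-enumerates true  H off = trans (cong (_+ (H true + 0)) (off false (λ ()))) (+-identityʳ (H true))

∑-allVecs-zipWith : ∀ {A B D : Set} (xs : List D) (ys : List A) (zs : List B) (g : A → B → D) →
  (∀ f → ∑ xs f ≡ ∑ ys (λ y → ∑ zs (λ z → f (g y z)))) →
  ∀ k (F : Vec D k → ℕ) →
  ∑ (allVecs xs k) F ≡ ∑ (allVecs ys k) (λ v → ∑ (allVecs zs k) (λ w → F (zipWith g v w)))
∑-allVecs-zipWith xs ys zs g split zero    F = sym (+-identityʳ _)
∑-allVecs-zipWith xs ys zs g split (suc k) F = begin
    ∑ (allVecs xs (suc k)) F
  ≡⟨ ∑-pairs xs (allVecs xs k) _∷_ F ⟩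
    ∑ xs (λ c → ∑ (allVecs xs k) (λ cs → F (c ∷ cs)))
  ≡⟨ ∑-cong xs (λ c → ∑-allVecs-zipWith xs ys zs g split k (F ∘ (c ∷_))) ⟩
    ∑ xs (λ c → ∑ Ys (λ v → ∑ Zs (λ w → F (c ∷ zipWith g v w))))
  ≡⟨ split _ ⟩
    ∑ ys (λ y → ∑ zs (λ z → ∑ Ys (λ v → ∑ Zs (λ w → F (g y z ∷ zipWith g v w)))))
  ≡⟨ ∑-cong ys (λ y → ∑-swap zs Ys _) ⟩
    ∑ ys (λ y → ∑ Ys (λ v → ∑ zs (λ z → ∑ Zs (λ w → F (zipWith g (y ∷ v) (z ∷ w))))))
  ≡⟨ ∑-cong ys (λ y → ∑-cong Ys (λ v → sym (∑-pairs zs Zs _∷_ (λ w → F (zipWith g (y ∷ v) w))))) ⟩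
    ∑ ys (λ y → ∑ Ys (λ v → ∑ (allVecs zs (suc k)) (λ w → F (zipWith g (y ∷ v) w))))
  ≡⟨ sym (∑-pairs ys Ys _∷_ _) ⟩
    ∑ (allVecs ys (suc k)) (λ v → ∑ (allVecs zs (suc k)) (λ w → F (zipWith g v w)))
  ∎
  where
  open ≡-Reasoning
  Ys = allVecs ys k
  Zs = allVecs zs k

module _ {A : Set} where

  staircase : ∀ {d} → ℕ → A → A → Vec A d
  staircase {zero}  _       z k = []
  staircase {suc d} zero    z k = replicate (suc d) k
  staircase {suc d} (suc p) z k = z ∷ staircase p z k

  data Staircase (z : A) (ks : List A) : ∀ {d} → Vec A d → Set where
    []   : Staircase z ks []
    z∷_  : ∀ {d} {hs : Vec A d} → Staircase z ks hs → Staircase z ks (z ∷ hs)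
    flat : ∀ {d k} → k ∈ ks → Staircase z ks (replicate (suc d) k)

  private
    replicate-staircase : ∀ {z ks} d → Staircase z ks (replicate d z)
    replicate-staircase zero    = []
    replicate-staircase (suc d) = z∷ replicate-staircase d

    staircase-tail : ∀ {z ks d} {hs : Vec A d} → Staircase z ks (z ∷ hs) → Staircase z ks hs
    staircase-tail (z∷ s)  = s
    staircase-tail {d = d} (flat _) = replicate-staircase d

    staircase-flat : ∀ {z ks d k} {hs : Vec A d} → z ≢ k → Staircase z ks (k ∷ hs) → hs ≡ replicate d k
    staircase-flat z≢k (z∷ _)  = ⊥-elim (z≢k refl)
    staircase-flat z≢k (flat _) = refl

    staircase-head : ∀ {z ks d h} {hs : Vec A d} → Staircase z ks (h ∷ hs) → h ∈ z ∷ ks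
    staircase-head (z∷ _)    = here refl
    staircase-head (flat k∈) = there k∈

  ∑-staircases : DecidableEquality A → ∀ {xs} → Enumerates xs → ∀ {z ks} → Unique (z ∷ ks) →
    ∀ d (F : Vec A d → ℕ) → (∀ hs → F hs ≢ 0 → Staircase z ks hs) →
    ∑ (allVecs xs d) F ≡ F (replicate d z) + ∑< d (λ p → ∑ ks (λ k → F (staircase p z k)))
  ∑-staircases _≟ᴬ_ enum uniq zero    F supp = refl
  ∑-staircases _≟ᴬ_ {xs} enum {z} {ks} uniq@(z∉ks ∷ _) (suc d) F supp = begin
      ∑ (allVecs xs (suc d)) F
    ≡⟨ ∑-pairs xs (allVecs xs d) _∷_ F ⟩
      ∑ xs K
    ≡⟨ ∑-support _≟ᴬ_ {xs} enum uniq K K-supp ⟩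
      K z + ∑ ks K
    ≡⟨ cong₂ _+_ (∑-staircases _≟ᴬ_ enum uniq d (F ∘ (z ∷_)) (λ hs ne → staircase-tail (supp (z ∷ hs) ne)))
                 (∑-cong-∈ ks K-flat) ⟩
      (F₀ + Rest) + ∑ ks (λ k → F (replicate (suc d) k))
    ≡⟨ +-assoc F₀ Rest _ ⟩
      F₀ + (Rest + ∑ ks (λ k → F (replicate (suc d) k)))
    ≡⟨ cong (F₀ +_) (+-comm Rest _) ⟩
      F₀ + ∑< (suc d) (λ p → ∑ ks (λ k → F (staircase p z k)))
    ∎
    where
    open ≡-Reasoning
    K : A → ℕ
    K h = ∑ (allVecs xs d) (λ hs → F (h ∷ hs))
    F₀ = F (replicate (suc d) z)
    Rest = ∑< d (λ p → ∑ ks (λ k → F (z ∷ staircase p z k)))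
    K-supp : ∀ h → K h ≢ 0 → h ∈ z ∷ ks
    K-supp h ne = let hs , _ , F≢0 = ∑≢0⇒∃ (allVecs xs d) _ ne in staircase-head (supp (h ∷ hs) F≢0)
    K-flat : ∀ {k} → k ∈ ks → K k ≡ F (replicate (suc d) k)
    K-flat {k} k∈ks = allVecs-enumerates enum d (replicate d k) (λ hs → F (k ∷ hs)) off
      where
      off : ∀ hs → hs ≢ replicate d k → F (k ∷ hs) ≡ 0
      off hs hs≢ = decidable-stable (F (k ∷ hs) ≟ 0)
        (λ ne → hs≢ (staircase-flat (λ z≡k → All.lookup z∉ks k∈ks z≡k) (supp (k ∷ hs) ne)))

∨-∧-ring : ACR.AlmostCommutativeRing 0ℓ 0ℓ
∨-∧-ring = ACR.fromCommutativeSemiring ∨-∧-commutativeSemiring λ { false → just refl ; true → nothing }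

∧-trueˡ : ∀ a {b} → a ∧ b ≡ true → a ≡ true
∧-trueˡ true  _ = refl

∧-trueʳ : ∀ a {b} → a ∧ b ≡ true → b ≡ true
∧-trueʳ true e = e

false≢true : false ≢ true
false≢true ()

∧-cong-if : ∀ {a a′} b → (b ≡ true → a ≡ a′) → a ∧ b ≡ a′ ∧ b
∧-cong-if {a} {a′} true  a≡a′ = cong (_∧ true) (a≡a′ refl)
∧-cong-if {a} {a′} false _    = trans (∧-zeroʳ a) (sym (∧-zeroʳ a′))

<ᵇ-true : ∀ {m k} → (m <ᵇ k) ≡ true → m < k
<ᵇ-true {m} {k} e = <ᵇ⇒< m k (Equivalence.from T-≡ e)

<⇒<ᵇ-true : ∀ {m k} → m < k → (m <ᵇ k) ≡ true
<⇒<ᵇ-true m<k = Equivalence.to T-≡ (<⇒<ᵇ m<k)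

<ᵇ-false : ∀ {m k} → (m <ᵇ k) ≡ false → k ≤ m
<ᵇ-false m≮k = ≮⇒≥ (λ m<k → false≢true (trans (sym m≮k) (<⇒<ᵇ-true m<k)))

≡ᵇ-true : ∀ m n → (m ≡ᵇ n) ≡ true → m ≡ n
≡ᵇ-true m n e = ≡ᵇ⇒≡ m n (Equivalence.from T-≡ e)

suc≡ᵇ : ∀ m u → (suc m ≡ᵇ u) ≡ (0 <ᵇ u) ∧ (m ≡ᵇ pred u)
suc≡ᵇ m zero    = refl
suc≡ᵇ m (suc u) = refl

allB-suc : ∀ {n} (f : Fin (suc n) → Bool) → allB f ≡ f fzero ∧ allB (f ∘ fsuc)
allB-suc f = cong (λ bs → f fzero ∧ and bs) (trans (map-tabulate fsuc f) (sym (map-tabulate id (f ∘ fsuc))))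

anyB-suc : ∀ {n} (f : Fin (suc n) → Bool) → anyB f ≡ f fzero ∨ anyB (f ∘ fsuc)
anyB-suc f = cong (λ bs → f fzero ∨ or bs) (trans (map-tabulate fsuc f) (sym (map-tabulate id (f ∘ fsuc))))

allB-cong : ∀ {n} {f g : Fin n → Bool} → (∀ i → f i ≡ g i) → allB f ≡ allB g
allB-cong {zero}          e = refl
allB-cong {suc n} {f} {g} e =
  trans (allB-suc f) (trans (cong₂ _∧_ (e fzero) (allB-cong (e ∘ fsuc))) (sym (allB-suc g)))

allB-true : ∀ {n} → allB {n} (λ _ → true) ≡ true
allB-true {zero}  = refl
allB-true {suc n} = trans (allB-suc {n} (λ _ → true)) (allB-true {n})

allB-∧ : ∀ {n} (f g : Fin n → Bool) → allB (λ i → f i ∧ g i) ≡ allB f ∧ allB g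
allB-∧ {zero}  f g = refl
allB-∧ {suc n} f g = begin
    allB (λ i → f i ∧ g i)
  ≡⟨ allB-suc (λ i → f i ∧ g i) ⟩
    (f fzero ∧ g fzero) ∧ allB (λ i → f (fsuc i) ∧ g (fsuc i))
  ≡⟨ cong ((f fzero ∧ g fzero) ∧_) (allB-∧ (f ∘ fsuc) (g ∘ fsuc)) ⟩
    (f fzero ∧ g fzero) ∧ (allB (f ∘ fsuc) ∧ allB (g ∘ fsuc))
  ≡⟨ interchange (f fzero) (g fzero) (allB (f ∘ fsuc)) (allB (g ∘ fsuc)) ⟩
    (f fzero ∧ allB (f ∘ fsuc)) ∧ (g fzero ∧ allB (g ∘ fsuc))
  ≡⟨ sym (cong₂ _∧_ (allB-suc f) (allB-suc g)) ⟩
    allB f ∧ allB g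
  ∎
  where
  open ≡-Reasoning
  interchange : ∀ a b c d → (a ∧ b) ∧ (c ∧ d) ≡ (a ∧ c) ∧ (b ∧ d)
  interchange = solve-∀-with ∨-∧-ring

allB-not : ∀ {n} (f : Fin n → Bool) → allB (λ i → not (f i)) ≡ not (anyB f)
allB-not {zero}  f = refl
allB-not {suc n} f = trans (allB-suc (not ∘ f))
  (trans (cong (not (f fzero) ∧_) (allB-not (f ∘ fsuc)))
         (trans (de-morgan (f fzero) _) (cong not (sym (anyB-suc f)))))
  where
  de-morgan : ∀ a b → not a ∧ not b ≡ not (a ∨ b)
  de-morgan true  b = refl
  de-morgan false b = refl

nonemptyB-∷ : ∀ {n} b (p : Subset n) → nonemptyB (b ∷ p) ≡ b ∨ nonemptyB p
nonemptyB-∷ b p = anyB-suc (lookup (b ∷ p))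

subsetB-∷ : ∀ {n} a b (p q : Subset n) → subsetB (a ∷ p) (b ∷ q) ≡ (not a ∨ b) ∧ subsetB p q
subsetB-∷ a b p q = allB-suc (λ i → not (lookup (a ∷ p) i) ∨ lookup (b ∷ q) i)

beforeB-∷ : ∀ {n} a b (p q : Subset n) →
  beforeB (a ∷ p) (b ∷ q) ≡ not (a ∧ b) ∧ ((not b ∨ not (nonemptyB p)) ∧ beforeB p q)
beforeB-∷ {n} a b p q = begin
    beforeB (a ∷ p) (b ∷ q)
  ≡⟨ allB-suc (λ i → allB (λ j → not (lookup (a ∷ p) i ∧ lookup (b ∷ q) j) ∨ (toℕ i <ᵇ toℕ j))) ⟩
    allB (λ j → not (a ∧ lookup (b ∷ q) j) ∨ (0 <ᵇ toℕ j)) ∧ Rest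
  ≡⟨ cong (_∧ Rest) (allB-suc (λ j → not (a ∧ lookup (b ∷ q) j) ∨ (0 <ᵇ toℕ j))) ⟩
    ((not (a ∧ b) ∨ false) ∧ allB (λ j → not (a ∧ lookup q j) ∨ true)) ∧ Rest
  ≡⟨ cong (λ c → ((not (a ∧ b) ∨ false) ∧ c) ∧ Rest)
          (trans (allB-cong (λ j → ∨-zeroʳ (not (a ∧ lookup q j)))) (allB-true {n})) ⟩
    ((not (a ∧ b) ∨ false) ∧ true) ∧ Rest
  ≡⟨ cong (_∧ Rest) (trans (∧-identityʳ _) (∨-identityʳ _)) ⟩
    not (a ∧ b) ∧ Rest
  ≡⟨ cong (not (a ∧ b) ∧_) Rest≡ ⟩
    not (a ∧ b) ∧ ((not b ∨ not (nonemptyB p)) ∧ beforeB p q)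
  ∎
  where
  open ≡-Reasoning
  Rest = allB (λ i → allB (λ j → not (lookup p i ∧ lookup (b ∷ q) j) ∨ (suc (toℕ i) <ᵇ toℕ j)))
  not-∧ : ∀ c d → not (c ∧ d) ≡ not d ∨ not c
  not-∧ true  d = sym (∨-identityʳ (not d))
  not-∧ false d = sym (∨-zeroʳ (not d))
  first-column : ∀ b → allB (λ i → not b ∨ not (lookup p i)) ≡ not b ∨ not (nonemptyB p)
  first-column true  = allB-not (lookup p)
  first-column false = allB-true {n}
  Rest≡ : Rest ≡ (not b ∨ not (nonemptyB p)) ∧ beforeB p q
  Rest≡ = begin
      Rest
    ≡⟨ allB-cong (λ i → allB-suc (λ j → not (lookup p i ∧ lookup (b ∷ q) j) ∨ (suc (toℕ i) <ᵇ toℕ j))) ⟩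
      allB (λ i → (not (lookup p i ∧ b) ∨ false) ∧ allB (λ j → not (lookup p i ∧ lookup q j) ∨ (toℕ i <ᵇ toℕ j)))
    ≡⟨ allB-∧ (λ i → not (lookup p i ∧ b) ∨ false) _ ⟩
      allB (λ i → not (lookup p i ∧ b) ∨ false) ∧ beforeB p q
    ≡⟨ cong (_∧ beforeB p q) (allB-cong (λ i → trans (∨-identityʳ _) (not-∧ (lookup p i) b))) ⟩
      allB (λ i → not b ∨ not (lookup p i)) ∧ beforeB p q
    ≡⟨ cong (_∧ beforeB p q) (first-column b) ⟩
      (not b ∨ not (nonemptyB p)) ∧ beforeB p q
    ∎

-- Splitting off the least element of [n]

prepend : ∀ {n k} → Vec Bool k → Vec (Subset n) k → Vec (Subset (suc n)) k
prepend = zipWith _∷_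

tuples : (n l : ℕ) → List (Tuple n l)
tuples n l = allVecs (allSubsets n) (suc l)

∑-allSubsets-suc : ∀ n (f : Subset (suc n) → ℕ) →
  ∑ (allSubsets (suc n)) f ≡ ∑ booleans (λ b → ∑ (allSubsets n) (λ a → f (b ∷ a)))
∑-allSubsets-suc n f = trans (∑-++ (map (false ∷_) A) _ f)
  (cong₂ _+_ (∑-map (false ∷_) A f) (trans (∑-map (true ∷_) A f) (sym (+-identityʳ _))))
  where A = allSubsets n

∑-tuples-suc : ∀ n l (F : Tuple (suc n) l → ℕ) →
  ∑ (tuples (suc n) l) F ≡ ∑ (allVecs booleans (suc l)) (λ h → ∑ (tuples n l) (λ x → F (prepend h x)))
∑-tuples-suc n l = ∑-allVecs-zipWith (allSubsets (suc n)) booleans (allSubsets n) _∷_ (∑-allSubsets-suc n) (suc l)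

∑-chains-suc : ∀ n l d (F : Vec (Tuple (suc n) l) d → ℕ) →
  ∑ (allVecs (tuples (suc n) l) d) F ≡
  ∑ (allVecs (allVecs booleans (suc l)) d) (λ hs → ∑ (allVecs (tuples n l) d) (λ ch → F (zipWith prepend hs ch)))
∑-chains-suc n l = ∑-allVecs-zipWith (tuples (suc n) l) (allVecs booleans (suc l)) (tuples n l) prepend (∑-tuples-suc n l)

size : ∀ {n k} → Vec (Subset n) k → ℕ
size x = ∣ ⋃ (toList x) ∣

size-prepend : ∀ {n k} (h : Vec Bool k) (x : Vec (Subset n) k) → size (prepend h x) ≡ ⟦ or (toList h) ⟧ + size x
size-prepend h x = trans (cong ∣_∣ (⋃-prepend h x)) (∣∷∣ (or (toList h)) (⋃ (toList x)))
  where
  ⋃-prepend : ∀ {k} (h : Vec Bool k) (x : Vec (Subset _) k) → ⋃ (toList (prepend h x)) ≡ or (toList h) ∷ ⋃ (toList x)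
  ⋃-prepend []      []      = refl
  ⋃-prepend (b ∷ h) (p ∷ x) = cong ((b ∷ p) ∪_) (⋃-prepend h x)
  ∣∷∣ : ∀ {m} b (p : Subset m) → ∣ b ∷ p ∣ ≡ ⟦ b ⟧ + ∣ p ∣
  ∣∷∣ true  p = refl
  ∣∷∣ false p = refl

size-0 : ∀ {k} (x : Vec (Subset 0) k) → size x ≡ 0
size-0 x with ⋃ (toList x)
... | [] = refl

data Prepended {n k} : Vec (Subset (suc n)) k → Set where
  prepended : ∀ h x → Prepended (prepend h x)

prepended? : ∀ {n k} (x : Vec (Subset (suc n)) k) → Prepended x
prepended? []            = prepended [] []
prepended? ((b ∷ p) ∷ x) with prepended? x
... | prepended h x′ = prepended (b ∷ h) (p ∷ x′)

none : ∀ {k} → Vec Bool k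
none = replicate _ false

only : ∀ {k} → ℕ → Vec Bool k
only {zero}  _       = []
only {suc k} zero    = true ∷ none
only {suc k} (suc j) = false ∷ only j

only-≥ : ∀ {k} j → k ≤ j → only {k} j ≡ none
only-≥ {zero}  j       _         = refl
only-≥ {suc k} (suc j) (s≤s k≤j) = cong (false ∷_) (only-≥ j k≤j)

or-none : ∀ k → or (toList (none {k})) ≡ false
or-none zero    = refl
or-none (suc k) = or-none k

or-only : ∀ {k} j → j < k → or (toList (only {k} j)) ≡ true
or-only {suc k} zero    _         = refl
or-only {suc k} (suc j) (s<s j<k) = or-only j j<k

leqBits : ∀ {k} → Vec Bool k → Vec Bool k → Bool
leqBits []      []        = true
leqBits (a ∷ h) (b ∷ h′) = (not a ∨ b) ∧ leqBits h h′

leqB-prepend : ∀ {n k} (h h′ : Vec Bool k) (x y : Vec (Subset n) k) →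
  leqB (prepend h x) (prepend h′ y) ≡ leqBits h h′ ∧ leqB x y
leqB-prepend []      []        []      []      = refl
leqB-prepend (a ∷ h) (b ∷ h′) (p ∷ x) (q ∷ y) =
  trans (cong₂ _∧_ (subsetB-∷ a b p q) (leqB-prepend h h′ x y))
        (interchange (not a ∨ b) (subsetB p q) (leqBits h h′) (leqB x y))
  where
  interchange : ∀ a b c d → (a ∧ b) ∧ (c ∧ d) ≡ (a ∧ c) ∧ (b ∧ d)
  interchange = solve-∀-with ∨-∧-ring

leqBits-none : ∀ {k} (h : Vec Bool k) → leqBits none h ≡ true
leqBits-none []      = refl
leqBits-none (_ ∷ h) = leqBits-none h

leqBits-refl : ∀ {k} (h : Vec Bool k) → leqBits h h ≡ true
leqBits-refl []          = refl
leqBits-refl (true ∷ h)  = leqBits-refl h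
leqBits-refl (false ∷ h) = leqBits-refl h

leqBits-only-none : ∀ {k} j → j < k → leqBits (only {k} j) none ≡ false
leqBits-only-none {suc k} zero    _         = refl
leqBits-only-none {suc k} (suc j) (s<s j<k) = leqBits-only-none j j<k

leqBits-only : ∀ {k} j j′ → j < k → leqBits (only {k} j) (only j′) ≡ true → j ≡ j′
leqBits-only {suc k} zero    zero     _         _ = refl
leqBits-only {suc k} (suc j) zero     (s<s j<k) e = ⊥-elim (false≢true (trans (sym (leqBits-only-none j j<k)) e))
leqBits-only {suc k} (suc j) (suc j′) (s<s j<k) e = cong suc (leqBits-only j j′ j<k e)

none≢only : ∀ {k} j → j < k → none ≢ only {k} j
none≢only {k} j j<k e = false≢true (trans (sym (or-none k)) (trans (cong (or ∘ toList) e) (or-only j j<k)))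

only-injective : ∀ {k} j j′ → j < k → only {k} j ≡ only j′ → j ≡ j′
only-injective {k} j j′ j<k e = leqBits-only j j′ j<k (trans (cong (leqBits (only j)) (sym e)) (leqBits-refl (only {k} j)))

leqBits⇒⟦or⟧≤ : ∀ {k} (h h′ : Vec Bool k) → leqBits h h′ ≡ true →
  ⟦ or (toList h) ⟧ ≤ ⟦ or (toList h′) ⟧
leqBits⇒⟦or⟧≤ []          []          _ = z≤n
leqBits⇒⟦or⟧≤ (true ∷ h)  (true ∷ h′) _ = ≤-refl
leqBits⇒⟦or⟧≤ (false ∷ h) (true ∷ h′) _ = ⟦⟧≤1 (or (toList h))
  where
  ⟦⟧≤1 : ∀ b → ⟦ b ⟧ ≤ 1
  ⟦⟧≤1 true  = ≤-refl
  ⟦⟧≤1 false = z≤n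
leqBits⇒⟦or⟧≤ (false ∷ h) (false ∷ h′) e = leqBits⇒⟦or⟧≤ h h′ e

leqB⇒size≤ : ∀ {n k} (x y : Vec (Subset n) k) → leqB x y ≡ true → size x ≤ size y
leqB⇒size≤ {zero}  x y _ = subst (_≤ size y) (sym (size-0 x)) z≤n
leqB⇒size≤ {suc n} x y x≤y with prepended? x | prepended? y
... | prepended h x′ | prepended h′ y′ =
  subst₂ _≤_ (sym (size-prepend h x′)) (sym (size-prepend h′ y′))
    (+-mono-≤ (leqBits⇒⟦or⟧≤ h h′ (∧-trueˡ (leqBits h h′) split))
              (leqB⇒size≤ x′ y′ (∧-trueʳ (leqBits h h′) split)))
  where
  split : leqBits h h′ ∧ leqB x′ y′ ≡ true
  split = trans (sym (leqB-prepend h h′ x′ y′)) x≤y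

size-none : ∀ {n k} (x : Vec (Subset n) k) → size (prepend none x) ≡ size x
size-none {k = k} x = trans (size-prepend none x) (cong (λ b → ⟦ b ⟧ + size x) (or-none k))

size-only : ∀ {n k} j (x : Vec (Subset n) k) → j < k → size (prepend (only j) x) ≡ suc (size x)
size-only j x j<k = trans (size-prepend (only j) x) (cong (λ b → ⟦ b ⟧ + size x) (or-only j j<k))

-- Tuples and chains relative to a block

-- x is the part, in a final segment of [n], of a tuple whose blocks before i lie entirely to
-- the left of the segment and whose block i has elements to the left of it iff s.
completesB : ∀ {n k} → ℕ → Bool → Vec (Subset n) k → Bool
completesB i       s []          = false
completesB zero    s (a ∷ [])    = s ∨ nonemptyB a
completesB zero    s (a ∷ b ∷ x) = (s ∨ nonemptyB a) ∧ (beforeB a b ∧ completesB zero false (b ∷ x))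
completesB (suc i) s (a ∷ [])    = false
completesB (suc i) s (a ∷ b ∷ x) = not (nonemptyB a) ∧ (beforeB a b ∧ completesB i s (b ∷ x))

completesB-isElemB : ∀ {n k} (x : Vec (Subset n) (suc k)) → completesB 0 false x ≡ isElemB x
completesB-isElemB (a ∷ [])    = unit (nonemptyB a)
  where
  unit : ∀ N → N ≡ (N ∧ true) ∧ true
  unit = solve-∀-with ∨-∧-ring
completesB-isElemB (a ∷ b ∷ x) =
  trans (cong (λ c → nonemptyB a ∧ (beforeB a b ∧ c)) (completesB-isElemB (b ∷ x)))
        (regroup (nonemptyB a) (beforeB a b) (allNonemptyB (b ∷ x)) (consecBeforeB (b ∷ x)))
  where
  regroup : ∀ N B A C → N ∧ (B ∧ (A ∧ C)) ≡ (N ∧ A) ∧ (B ∧ C)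
  regroup = solve-∀-with ∨-∧-ring

completesB-≥ : ∀ {n k} i s (x : Vec (Subset n) k) → k ≤ i → completesB i s x ≡ false
completesB-≥ i       s []          _         = refl
completesB-≥ (suc i) s (a ∷ [])    _         = refl
completesB-≥ (suc i) s (a ∷ b ∷ x) (s≤s k≤i) =
  trans (cong (λ c → not (nonemptyB a) ∧ (beforeB a b ∧ c)) (completesB-≥ i s (b ∷ x) k≤i))
        (absorb (not (nonemptyB a)) (beforeB a b))
  where
  absorb : ∀ a b → a ∧ (b ∧ false) ≡ false
  absorb = solve-∀-with ∨-∧-ring

completesB-none : ∀ {n k} i s (x : Vec (Subset n) k) → completesB i s (prepend none x) ≡ completesB i s x
completesB-none i       s []          = refl
completesB-none zero    s (a ∷ [])    = cong (s ∨_) (nonemptyB-∷ false a)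
completesB-none zero    s (a ∷ b ∷ x) = cong₂ (λ u v → (s ∨ u) ∧ v) (nonemptyB-∷ false a)
  (cong₂ _∧_ (beforeB-∷ false false a b) (completesB-none zero false (b ∷ x)))
completesB-none (suc i) s (a ∷ [])    = refl
completesB-none (suc i) s (a ∷ b ∷ x) = cong₂ (λ u v → not u ∧ v) (nonemptyB-∷ false a)
  (cong₂ _∧_ (beforeB-∷ false false a b) (completesB-none i s (b ∷ x)))

completesB-only : ∀ {n k} i s (x : Vec (Subset n) k) → i < k →
  completesB i s (prepend (only i) x) ≡ completesB i true x
completesB-only zero s (a ∷ [])    _ = trans (cong (s ∨_) (nonemptyB-∷ true a)) (∨-zeroʳ s)
completesB-only zero s (a ∷ b ∷ x) _ =
  trans (cong₂ (λ u v → (s ∨ u) ∧ v) (nonemptyB-∷ true a)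
               (cong₂ _∧_ (beforeB-∷ true false a b) (completesB-none zero false (b ∷ x))))
        (cong (_∧ _) (∨-zeroʳ s))
completesB-only (suc i) s (a ∷ [])    (s<s ())
completesB-only (suc zero) s (a ∷ b ∷ x) (s<s i<k) =
  trans (cong₂ (λ u v → not u ∧ v) (nonemptyB-∷ false a)
               (cong₂ _∧_ (beforeB-∷ false true a b) (completesB-only zero s (b ∷ x) i<k)))
        (idem (not (nonemptyB a)) (beforeB a b) (completesB zero true (b ∷ x)))
  where
  idem : ∀ a b c → a ∧ ((a ∧ b) ∧ c) ≡ a ∧ (b ∧ c)
  idem true  b c = refl
  idem false b c = refl
completesB-only (suc (suc i)) s (a ∷ b ∷ x) (s<s i<k) =
  cong₂ (λ u v → not u ∧ v) (nonemptyB-∷ false a)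
        (cong₂ _∧_ (beforeB-∷ false false a b) (completesB-only (suc i) s (b ∷ x) i<k))

completesB-only-next : ∀ {n k} i s (x : Vec (Subset n) k) → suc i < k →
  completesB i s (prepend (only (suc i)) x) ≡ s ∧ completesB (suc i) true x
completesB-only-next zero s (a ∷ b ∷ x) (s<s i<k) =
  trans (cong₂ (λ u v → (s ∨ u) ∧ v) (nonemptyB-∷ false a)
               (cong₂ _∧_ (beforeB-∷ false true a b) (completesB-only zero false (b ∷ x) i<k)))
        (regroup s (nonemptyB a) (beforeB a b) (completesB zero true (b ∷ x)))
  where
  regroup : ∀ s N B c → (s ∨ N) ∧ ((not N ∧ B) ∧ c) ≡ s ∧ (not N ∧ (B ∧ c))
  regroup true  true  B c = refl
  regroup true  false B c = refl
  regroup false true  B c = refl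
  regroup false false B c = refl
completesB-only-next (suc i) s (a ∷ b ∷ x) (s<s i<k) =
  trans (cong₂ (λ u v → not u ∧ v) (nonemptyB-∷ false a)
               (cong₂ _∧_ (beforeB-∷ false false a b) (completesB-only-next i s (b ∷ x) i<k)))
        (regroup s (not (nonemptyB a)) (beforeB a b) (completesB (suc i) true (b ∷ x)))
  where
  regroup : ∀ s x y c → x ∧ (y ∧ (s ∧ c)) ≡ s ∧ (x ∧ (y ∧ c))
  regroup = solve-∀-with ∨-∧-ring

completesB-prepend-shape : ∀ {n k} i s (x : Vec (Subset n) k) (h : Vec Bool k) →
  completesB i s (prepend h x) ≡ true → h ≡ none ⊎ h ≡ only i ⊎ h ≡ only (suc i)
completesB-prepend-shape i s [] [] ()
completesB-prepend-shape zero s (a ∷ []) (false ∷ []) _ = inj₁ refl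
completesB-prepend-shape zero s (a ∷ []) (true ∷ [])  _ = inj₂ (inj₁ refl)
completesB-prepend-shape zero s (a ∷ b ∷ x) (ha ∷ hb ∷ h) ok =
  head ha ordered (completesB-prepend-shape zero false (b ∷ x) (hb ∷ h) ok-tail)
  where
  ok-tail : completesB zero false (prepend (hb ∷ h) (b ∷ x)) ≡ true
  ok-tail = ∧-trueʳ (beforeB (ha ∷ a) (hb ∷ b)) (∧-trueʳ (s ∨ nonemptyB (ha ∷ a)) ok)
  ordered : not (ha ∧ hb) ≡ true
  ordered = ∧-trueˡ (not (ha ∧ hb))
    (trans (sym (beforeB-∷ ha hb a b)) (∧-trueˡ (beforeB (ha ∷ a) (hb ∷ b)) (∧-trueʳ (s ∨ nonemptyB (ha ∷ a)) ok)))
  next-is-none′ : ∀ {k} (x : Vec (Subset _) k) h′ → completesB zero false (prepend h′ (b ∷ x)) ≡ true →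
                  h′ ≡ only 1 → h′ ≡ none
  next-is-none′ []      h′ _  e = trans e (only-≥ 1 (s≤s z≤n))
  next-is-none′ (c ∷ x) h′ ok e = ⊥-elim (false≢true (trans (sym (completesB-only-next zero false (b ∷ c ∷ x) (s<s z<s)))
    (trans (cong (λ h″ → completesB zero false (prepend h″ (b ∷ c ∷ x))) (sym e)) ok)))
  next-is-none : hb ∷ h ≡ only 1 → hb ∷ h ≡ none
  next-is-none = next-is-none′ x (hb ∷ h) ok-tail
  head : ∀ ha → not (ha ∧ hb) ≡ true → hb ∷ h ≡ none ⊎ hb ∷ h ≡ only 0 ⊎ hb ∷ h ≡ only 1 →
         ha ∷ hb ∷ h ≡ none ⊎ ha ∷ hb ∷ h ≡ only 0 ⊎ ha ∷ hb ∷ h ≡ only 1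
  head true  _  (inj₁ e)        = inj₂ (inj₁ (cong (true ∷_) e))
  head true  ok (inj₂ (inj₁ e)) = ⊥-elim (false≢true (trans (sym (cong (λ h′ → not (true ∧ Vec.head h′)) e)) ok))
  head true  _  (inj₂ (inj₂ e)) = inj₂ (inj₁ (cong (true ∷_) (next-is-none e)))
  head false _  (inj₁ e)        = inj₁ (cong (false ∷_) e)
  head false _  (inj₂ (inj₁ e)) = inj₂ (inj₂ (cong (false ∷_) e))
  head false _  (inj₂ (inj₂ e)) = inj₁ (cong (false ∷_) (next-is-none e))
completesB-prepend-shape (suc i) s (a ∷ []) (_ ∷ []) ()
completesB-prepend-shape (suc i) s (a ∷ b ∷ x) (ha ∷ hb ∷ h) ok =
  head ha (∧-trueˡ (not (nonemptyB (ha ∷ a))) ok)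
       (completesB-prepend-shape i s (b ∷ x) (hb ∷ h)
         (∧-trueʳ (beforeB (ha ∷ a) (hb ∷ b)) (∧-trueʳ (not (nonemptyB (ha ∷ a))) ok)))
  where
  head : ∀ ha → not (nonemptyB (ha ∷ a)) ≡ true → hb ∷ h ≡ none ⊎ hb ∷ h ≡ only i ⊎ hb ∷ h ≡ only (suc i) →
         ha ∷ hb ∷ h ≡ none ⊎ ha ∷ hb ∷ h ≡ only (suc i) ⊎ ha ∷ hb ∷ h ≡ only (suc (suc i))
  head true  e _                 = ⊥-elim (false≢true (trans (sym (cong not (nonemptyB-∷ true a))) e))
  head false _ (inj₁ e)        = inj₁ (cong (false ∷_) e)
  head false _ (inj₂ (inj₁ e)) = inj₂ (inj₁ (cong (false ∷_) e))
  head false _ (inj₂ (inj₂ e)) = inj₂ (inj₂ (cong (false ∷_) e))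

emptyAtB : ∀ {n k} → ℕ → Vec (Subset n) k → Bool
emptyAtB i       []      = true
emptyAtB zero    (a ∷ x) = not (nonemptyB a)
emptyAtB (suc i) (a ∷ x) = emptyAtB i x

completesB-suc⇒emptyAtB : ∀ {n k} i s (x : Vec (Subset n) k) → completesB (suc i) s x ≡ true → emptyAtB i x ≡ true
completesB-suc⇒emptyAtB zero    s (a ∷ b ∷ x) ok = ∧-trueˡ (not (nonemptyB a)) ok
completesB-suc⇒emptyAtB (suc i) s (a ∷ b ∷ x) ok =
  completesB-suc⇒emptyAtB i s (b ∷ x) (∧-trueʳ (beforeB a b) (∧-trueʳ (not (nonemptyB a)) ok))

completesB-emptyAtB : ∀ {n k} i s (x : Vec (Subset n) k) → suc i < k →
  completesB i s x ∧ emptyAtB i x ≡ s ∧ completesB (suc i) false x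
completesB-emptyAtB zero    s (a ∷ [])    (s<s ())
completesB-emptyAtB (suc i) s (a ∷ [])    (s<s ())
completesB-emptyAtB zero s (a ∷ b ∷ x) _ = regroup s (nonemptyB a) (beforeB a b) (completesB zero false (b ∷ x))
  where
  regroup : ∀ s N B c → ((s ∨ N) ∧ (B ∧ c)) ∧ not N ≡ s ∧ (not N ∧ (B ∧ c))
  regroup true  true  B c = ∧-zeroʳ (B ∧ c)
  regroup true  false B c = ∧-identityʳ (B ∧ c)
  regroup false true  B c = ∧-zeroʳ (B ∧ c)
  regroup false false B c = refl
completesB-emptyAtB (suc i) s (a ∷ b ∷ x) (s<s i<k) = begin
    (E ∧ (B ∧ completesB i s (b ∷ x))) ∧ emptyAtB i (b ∷ x)
  ≡⟨ assoc E B (completesB i s (b ∷ x)) (emptyAtB i (b ∷ x)) ⟩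
    E ∧ (B ∧ (completesB i s (b ∷ x) ∧ emptyAtB i (b ∷ x)))
  ≡⟨ cong (λ c → E ∧ (B ∧ c)) (completesB-emptyAtB i s (b ∷ x) i<k) ⟩
    E ∧ (B ∧ (s ∧ completesB (suc i) false (b ∷ x)))
  ≡⟨ regroup s E B (completesB (suc i) false (b ∷ x)) ⟩
    s ∧ (E ∧ (B ∧ completesB (suc i) false (b ∷ x)))
  ∎
  where
  open ≡-Reasoning
  E = not (nonemptyB a)
  B = beforeB a b
  assoc : ∀ x y c e → (x ∧ (y ∧ c)) ∧ e ≡ x ∧ (y ∧ (c ∧ e))
  assoc = solve-∀-with ∨-∧-ring
  regroup : ∀ s x y c → x ∧ (y ∧ (s ∧ c)) ≡ s ∧ (x ∧ (y ∧ c))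
  regroup = solve-∀-with ∨-∧-ring

subsetB-empty : ∀ {n} (a b : Subset n) → subsetB a b ≡ true → not (nonemptyB b) ≡ true → not (nonemptyB a) ≡ true
subsetB-empty []      []      _   _  = refl
subsetB-empty (x ∷ a) (y ∷ b) a⊆b b∅ =
  head x y (trans (sym (subsetB-∷ x y a b)) a⊆b) (trans (cong not (sym (nonemptyB-∷ y b))) b∅)
  where
  head : ∀ x y → (not x ∨ y) ∧ subsetB a b ≡ true → not (y ∨ nonemptyB b) ≡ true → not (nonemptyB (x ∷ a)) ≡ true
  head x     true  _   ()
  head true  false ()
  head false false a⊆b b∅ = trans (cong not (nonemptyB-∷ false a)) (subsetB-empty a b a⊆b b∅)

leqB-emptyAtB : ∀ {n k} i (x y : Vec (Subset n) k) → leqB x y ≡ true → emptyAtB i y ≡ true → emptyAtB i x ≡ true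
leqB-emptyAtB i       []      []      _   _ = refl
leqB-emptyAtB zero    (a ∷ x) (b ∷ y) x≤y e = subsetB-empty a b (∧-trueˡ (subsetB a b) x≤y) e
leqB-emptyAtB (suc i) (a ∷ x) (b ∷ y) x≤y e = leqB-emptyAtB i x y (∧-trueʳ (subsetB a b) x≤y) e

leqNextB : ∀ {n l d} → Tuple n l → Vec (Tuple n l) d → Bool
leqNextB x []      = true
leqNextB x (y ∷ _) = leqB x y

-- An increasing chain with sizes us whose members complete from block i, block i meeting the
-- left part from chain position t on.
chainB : ∀ {n l d} → ℕ → ℕ → Vec ℕ d → Vec (Tuple n l) d → Bool
chainB i t []       []       = true
chainB i t (u ∷ us) (x ∷ ch) =
  completesB i (t ≡ᵇ 0) x ∧ ((size x ≡ᵇ u) ∧ (leqNextB x ch ∧ chainB i (pred t) us ch))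

completions : (n l i t : ℕ) → ∀ {d} → Vec ℕ d → ℕ
completions n l i t {d} us = ∑ (allVecs (tuples n l) d) (λ ch → ⟦ chainB i t us ch ⟧)

chainB-sorted : ∀ {n l d} i t (us : Vec ℕ d) (ch : Vec (Tuple n l) d) → chainB i t us ch ≡ true → Linked _≤_ (toList us)
chainB-sorted i t []           []           _  = []
chainB-sorted i t (u ∷ [])     (x ∷ [])     _  = [-]
chainB-sorted i t (u ∷ v ∷ us) (x ∷ y ∷ ch) ok =
  subst₂ _≤_ (≡ᵇ-true (size x) u size-x) (≡ᵇ-true (size y) v size-y) (leqB⇒size≤ x y x≤y)
  ∷ chainB-sorted i (pred t) (v ∷ us) (y ∷ ch) rest
  where
  ok₁  = ∧-trueʳ (completesB i (t ≡ᵇ 0) x) ok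
  size-x = ∧-trueˡ (size x ≡ᵇ u) ok₁
  ok₂  = ∧-trueʳ (size x ≡ᵇ u) ok₁
  x≤y  = ∧-trueˡ (leqB x y) ok₂
  rest = ∧-trueʳ (leqB x y) ok₂
  size-y = ∧-trueˡ (size y ≡ᵇ v) (∧-trueʳ (completesB i (pred t ≡ᵇ 0) y) rest)

positiveFromB : ∀ {d} → ℕ → Vec ℕ d → Bool
positiveFromB p       []       = true
positiveFromB zero    (u ∷ us) = (0 <ᵇ u) ∧ positiveFromB zero us
positiveFromB (suc p) (u ∷ us) = positiveFromB p us

decrementFrom : ∀ {d} → ℕ → Vec ℕ d → Vec ℕ d
decrementFrom zero    us       = Vec.map pred us
decrementFrom (suc p) []       = []
decrementFrom (suc p) (u ∷ us) = u ∷ decrementFrom p us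

module _ {n l : ℕ} where

  leqNextB-none : ∀ {d} (x : Tuple n l) (hs : Vec (Vec Bool (suc l)) d) ch →
    leqNextB (prepend none x) (zipWith prepend hs ch) ≡ leqNextB x ch
  leqNextB-none x []        []       = refl
  leqNextB-none x (h′ ∷ hs) (y ∷ ch) = trans (leqB-prepend none h′ x y) (cong (_∧ leqB x y) (leqBits-none h′))

  leqNextB-replicate : ∀ {d} (h : Vec Bool (suc l)) (x : Tuple n l) (ch : Vec (Tuple n l) d) →
    leqNextB (prepend h x) (zipWith prepend (replicate d h) ch) ≡ leqNextB x ch
  leqNextB-replicate h x []       = refl
  leqNextB-replicate h x (y ∷ ch) = trans (leqB-prepend h h x y) (cong (_∧ leqB x y) (leqBits-refl h))

  chainB-none : ∀ {d} i t (us : Vec ℕ d) (ch : Vec (Tuple n l) d) →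
    chainB i t us (zipWith prepend (replicate d none) ch) ≡ chainB i t us ch
  chainB-none i t []       []       = refl
  chainB-none i t (u ∷ us) (x ∷ ch) =
    cong₂ _∧_ (completesB-none i (t ≡ᵇ 0) x)
      (cong₂ _∧_ (cong (_≡ᵇ u) (size-none x))
        (cong₂ _∧_ (leqNextB-none x (replicate _ none) ch) (chainB-none i (pred t) us ch)))

  chainB-only : ∀ {d} i t (us : Vec ℕ d) (ch : Vec (Tuple n l) d) → i < suc l →
    chainB i t us (zipWith prepend (replicate d (only i)) ch) ≡ positiveFromB 0 us ∧ chainB i 0 (Vec.map pred us) ch
  chainB-only i t []       []       _   = refl
  chainB-only i t (u ∷ us) (x ∷ ch) i<k = begin
      completesB i (t ≡ᵇ 0) (prepend (only i) x) ∧ ((size (prepend (only i) x) ≡ᵇ u) ∧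
        (leqNextB (prepend (only i) x) (zipWith prepend (replicate _ (only i)) ch) ∧ chainB i (pred t) us _))
    ≡⟨ cong₂ _∧_ (completesB-only i (t ≡ᵇ 0) x i<k)
         (cong₂ _∧_ (trans (cong (_≡ᵇ u) (size-only i x i<k)) (suc≡ᵇ (size x) u))
           (cong₂ _∧_ (leqNextB-replicate (only i) x ch) (chainB-only i (pred t) us ch i<k))) ⟩
      completesB i true x ∧ (((0 <ᵇ u) ∧ (size x ≡ᵇ pred u)) ∧
        (leqNextB x ch ∧ (positiveFromB 0 us ∧ chainB i 0 (Vec.map pred us) ch)))
    ≡⟨ regroup (completesB i true x) (0 <ᵇ u) (size x ≡ᵇ pred u) (leqNextB x ch) (positiveFromB 0 us) _ ⟩
      ((0 <ᵇ u) ∧ positiveFromB 0 us) ∧ chainB i 0 (Vec.map pred (u ∷ us)) (x ∷ ch)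
    ∎
    where
    open ≡-Reasoning
    regroup : ∀ g a e q o c → g ∧ ((a ∧ e) ∧ (q ∧ (o ∧ c))) ≡ (a ∧ o) ∧ (g ∧ (e ∧ (q ∧ c)))
    regroup = solve-∀-with ∨-∧-ring

  chainB-staircase-only : ∀ {d} i t p (us : Vec ℕ d) (ch : Vec (Tuple n l) d) → i < suc l →
    chainB i t us (zipWith prepend (staircase p none (only i)) ch) ≡
    positiveFromB p us ∧ chainB i (t ⊓ p) (decrementFrom p us) ch
  chainB-staircase-only i t zero    []       []       _   = refl
  chainB-staircase-only i t zero    (u ∷ us) (x ∷ ch) i<k =
    trans (chainB-only i t (u ∷ us) (x ∷ ch) i<k)
      (cong (λ t′ → positiveFromB 0 (u ∷ us) ∧ chainB i t′ (Vec.map pred (u ∷ us)) (x ∷ ch)) (sym (⊓-zeroʳ t)))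
  chainB-staircase-only i t (suc p) []       []       _   = refl
  chainB-staircase-only i t (suc p) (u ∷ us) (x ∷ ch) i<k = begin
      completesB i (t ≡ᵇ 0) (prepend none x) ∧ ((size (prepend none x) ≡ᵇ u) ∧
        (leqNextB (prepend none x) (zipWith prepend hs ch) ∧ chainB i (pred t) us (zipWith prepend hs ch)))
    ≡⟨ cong₂ _∧_ (completesB-none i (t ≡ᵇ 0) x)
         (cong₂ _∧_ (cong (_≡ᵇ u) (size-none x))
           (cong₂ _∧_ (leqNextB-none x hs ch) (chainB-staircase-only i (pred t) p us ch i<k))) ⟩
      completesB i (t ≡ᵇ 0) x ∧ ((size x ≡ᵇ u) ∧
        (leqNextB x ch ∧ (positiveFromB p us ∧ chainB i (pred t ⊓ p) (decrementFrom p us) ch)))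
    ≡⟨ regroup (completesB i (t ≡ᵇ 0) x) (size x ≡ᵇ u) (leqNextB x ch) (positiveFromB p us) _ ⟩
      positiveFromB p us ∧ (completesB i (t ≡ᵇ 0) x ∧ ((size x ≡ᵇ u) ∧
        (leqNextB x ch ∧ chainB i (pred t ⊓ p) (decrementFrom p us) ch)))
    ≡⟨ cong (positiveFromB p us ∧_) (chainB-min t) ⟩
      positiveFromB p us ∧ chainB i (t ⊓ suc p) (decrementFrom (suc p) (u ∷ us)) (x ∷ ch)
    ∎
    where
    open ≡-Reasoning
    hs = staircase p none (only i)
    regroup : ∀ g e q o c → g ∧ (e ∧ (q ∧ (o ∧ c))) ≡ o ∧ (g ∧ (e ∧ (q ∧ c)))
    regroup = solve-∀-with ∨-∧-ring
    chainB-min : ∀ t →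
      completesB i (t ≡ᵇ 0) x ∧ ((size x ≡ᵇ u) ∧ (leqNextB x ch ∧ chainB i (pred t ⊓ p) (decrementFrom p us) ch))
      ≡ chainB i (t ⊓ suc p) (u ∷ decrementFrom p us) (x ∷ ch)
    chainB-min zero    = refl
    chainB-min (suc t) = refl

  private
    chainB-only-next-head : ∀ {d} i t u (us : Vec ℕ d) x (ch : Vec (Tuple n l) d) → suc i < suc l →
      chainB i t (u ∷ us) (zipWith prepend (replicate (suc d) (only (suc i))) (x ∷ ch)) ≡
      ((t ≡ᵇ 0) ∧ completesB (suc i) true x) ∧ (((0 <ᵇ u) ∧ (size x ≡ᵇ pred u)) ∧
        (leqNextB x ch ∧ chainB i (pred t) us (zipWith prepend (replicate d (only (suc i))) ch)))
    chainB-only-next-head i t u us x ch i<k =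
      cong₂ _∧_ (completesB-only-next i (t ≡ᵇ 0) x i<k)
        (cong₂ _∧_ (trans (cong (_≡ᵇ u) (size-only (suc i) x i<k)) (suc≡ᵇ (size x) u))
          (cong (_∧ _) (leqNextB-replicate (only (suc i)) x ch)))

  chainB-only-next : ∀ {d} i t u (us : Vec ℕ d) (ch : Vec (Tuple n l) (suc d)) → suc i < suc l →
    chainB i t (u ∷ us) (zipWith prepend (replicate (suc d) (only (suc i))) ch) ≡
    positiveFromB 0 (u ∷ us) ∧ ((t ≡ᵇ 0) ∧ chainB (suc i) 0 (Vec.map pred (u ∷ us)) ch)
  chainB-only-next i t u [] (x ∷ []) i<k =
    trans (chainB-only-next-head i t u [] x [] i<k)
          (regroup (t ≡ᵇ 0) (completesB (suc i) true x) (0 <ᵇ u) (size x ≡ᵇ pred u))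
    where
    regroup : ∀ s g a e →
      (s ∧ g) ∧ ((a ∧ e) ∧ (true ∧ true)) ≡ (a ∧ true) ∧ (s ∧ (g ∧ (e ∧ (true ∧ true))))
    regroup = solve-∀-with ∨-∧-ring
  chainB-only-next i zero u (v ∷ us) (x ∷ y ∷ ch) i<k =
    trans (chainB-only-next-head i zero u (v ∷ us) x (y ∷ ch) i<k)
      (trans (cong (λ c → (true ∧ completesB (suc i) true x) ∧ (((0 <ᵇ u) ∧ (size x ≡ᵇ pred u)) ∧ (leqB x y ∧ c)))
                   (chainB-only-next i zero v us (y ∷ ch) i<k))
             (regroup (completesB (suc i) true x) (0 <ᵇ u) (size x ≡ᵇ pred u) (leqB x y) (positiveFromB 0 (v ∷ us)) _))
    where
    regroup : ∀ g a e q o c →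
      (true ∧ g) ∧ ((a ∧ e) ∧ (q ∧ (o ∧ (true ∧ c)))) ≡ (a ∧ o) ∧ (true ∧ (g ∧ (e ∧ (q ∧ c))))
    regroup = solve-∀-with ∨-∧-ring
  chainB-only-next i (suc t) u (v ∷ us) (x ∷ y ∷ ch) i<k =
    trans (chainB-only-next-head i (suc t) u (v ∷ us) x (y ∷ ch) i<k)
      (trans (cong (λ c → (false ∧ completesB (suc i) true x) ∧ (((0 <ᵇ u) ∧ (size x ≡ᵇ pred u)) ∧ (leqB x y ∧ c)))
                   (chainB-only-next i t v us (y ∷ ch) i<k))
             (regroup (completesB (suc i) true x) (0 <ᵇ u) (size x ≡ᵇ pred u) (leqB x y) (positiveFromB 0 (v ∷ us))
                      (t ≡ᵇ 0) (chainB (suc i) 0 (Vec.map pred (v ∷ us)) (y ∷ ch))))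
    where
    regroup : ∀ g a e q o z c →
      (false ∧ g) ∧ ((a ∧ e) ∧ (q ∧ (o ∧ (z ∧ c)))) ≡ (a ∧ o) ∧ (false ∧ (g ∧ (e ∧ (q ∧ c))))
    regroup = solve-∀-with ∨-∧-ring

  -- x lies below a member whose block i is empty, so its own block i is empty as well.
  completesB-below-next : ∀ {d} i t p (us : Vec ℕ (suc d)) (x : Tuple n l) (ch : Vec (Tuple n l) (suc d)) → suc i < suc l →
    leqNextB x ch ≡ true → chainB (suc i) p us ch ≡ true →
    completesB i (t ≡ᵇ 0) x ≡ (t ≡ᵇ 0) ∧ completesB (suc i) false x
  completesB-below-next i t p (u ∷ us) x (y ∷ ch) i<k x≤y ok =
    trans (sym (∧-identityʳ _))
      (trans (cong (completesB i (t ≡ᵇ 0) x ∧_) (sym x-empty)) (completesB-emptyAtB i (t ≡ᵇ 0) x i<k))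
    where
    x-empty : emptyAtB i x ≡ true
    x-empty = leqB-emptyAtB i x y x≤y
      (completesB-suc⇒emptyAtB i (p ≡ᵇ 0) y (∧-trueˡ (completesB (suc i) (p ≡ᵇ 0) y) ok))

  chainB-staircase-only-next : ∀ {d} i t p (us : Vec ℕ d) (ch : Vec (Tuple n l) d) → suc i < suc l → p < d →
    chainB i t us (zipWith prepend (staircase p none (only (suc i))) ch) ≡
    positiveFromB p us ∧ ((t ≡ᵇ 0) ∧ chainB (suc i) p (decrementFrom p us) ch)
  chainB-staircase-only-next i t zero    (u ∷ us) ch i<k _ = chainB-only-next i t u us ch i<k
  chainB-staircase-only-next i t (suc p) (u ∷ []) (x ∷ []) i<k (s<s ())
  chainB-staircase-only-next i t (suc p) (u ∷ us@(_ ∷ _)) (x ∷ ch@(_ ∷ _)) i<k (s<s p<d) = begin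
      completesB i s (prepend none x) ∧ ((size (prepend none x) ≡ᵇ u) ∧
        (leqNextB (prepend none x) (zipWith prepend hs ch) ∧ chainB i (pred t) us (zipWith prepend hs ch)))
    ≡⟨ cong₂ _∧_ (completesB-none i s x)
         (cong₂ _∧_ (cong (_≡ᵇ u) (size-none x))
           (cong₂ _∧_ (leqNextB-none x hs ch) (chainB-staircase-only-next i (pred t) p us ch i<k p<d))) ⟩
      completesB i s x ∧ (E ∧ (Q ∧ (O ∧ (z ∧ P))))
    ≡⟨ ∧-cong-if (E ∧ (Q ∧ (O ∧ (z ∧ P)))) (λ ok → completesB-below-next i t p (decrementFrom p us) x ch i<k
          (∧-trueˡ Q (∧-trueʳ E ok)) (∧-trueʳ z (∧-trueʳ O (∧-trueʳ Q (∧-trueʳ E ok))))) ⟩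
      (s ∧ G) ∧ (E ∧ (Q ∧ (O ∧ (z ∧ P))))
    ≡⟨ regroup s G E Q O z P ⟩
      O ∧ ((s ∧ z) ∧ (G ∧ (E ∧ (Q ∧ P))))
    ≡⟨ cong (λ c → O ∧ (c ∧ (G ∧ (E ∧ (Q ∧ P))))) (witnessed-earlier t) ⟩
      O ∧ (s ∧ (G ∧ (E ∧ (Q ∧ P))))
    ∎
    where
    open ≡-Reasoning
    hs = staircase p none (only (suc i))
    s = t ≡ᵇ 0
    z = pred t ≡ᵇ 0
    G = completesB (suc i) false x
    E = size x ≡ᵇ u
    Q = leqNextB x ch
    O = positiveFromB p us
    P = chainB (suc i) p (decrementFrom p us) ch
    regroup : ∀ s g e q o z c → (s ∧ g) ∧ (e ∧ (q ∧ (o ∧ (z ∧ c)))) ≡ o ∧ ((s ∧ z) ∧ (g ∧ (e ∧ (q ∧ c))))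
    regroup = solve-∀-with ∨-∧-ring
    witnessed-earlier : ∀ t → (t ≡ᵇ 0) ∧ (pred t ≡ᵇ 0) ≡ (t ≡ᵇ 0)
    witnessed-earlier zero    = refl
    witnessed-earlier (suc t) = refl

  nextCandidate : ℕ → List (Vec Bool (suc l))
  nextCandidate i = if i <ᵇ l then [ only (suc i) ] else []

  candidates : ℕ → List (Vec Bool (suc l))
  candidates i = only i ∷ nextCandidate i

  ∑-candidates : ∀ i (f : Vec Bool (suc l) → ℕ) → ∑ (candidates i) f ≡ f (only i) + ⟦ i <ᵇ l ⟧ * f (only (suc i))
  ∑-candidates i f with i <ᵇ l
  ... | true  = cong (f (only i) +_) (trans (+-identityʳ _) (sym (+-identityʳ _)))
  ... | false = refl

  private
    candidate-only : ∀ i → i < suc l → ∀ {h} → h ∈ candidates i → ∃[ j ] j < suc l × h ≡ only j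
    candidate-only i i<k (here e) = i , i<k , e
    candidate-only i i<k (there h∈) with i <ᵇ l in lt
    candidate-only i i<k (there (here e)) | true = suc i , s<s (<ᵇ-true lt) , e

    candidates-comparable : ∀ i → i < suc l → ∀ {h h′} → h ∈ candidates i → h′ ∈ candidates i →
      leqBits h h′ ≡ true → h ≡ h′
    candidates-comparable i i<k h∈ h′∈ h≤h′ with candidate-only i i<k h∈ | candidate-only i i<k h′∈
    ... | j , j<k , refl | j′ , _ , refl = cong only (leqBits-only j j′ j<k h≤h′)

    shape-candidate : ∀ i → i < suc l → ∀ h →
      h ≡ none ⊎ h ≡ only i ⊎ h ≡ only (suc i) → h ≡ none ⊎ h ∈ candidates i
    shape-candidate i i<k h (inj₁ e)        = inj₁ e
    shape-candidate i i<k h (inj₂ (inj₁ e)) = inj₂ (here e)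
    shape-candidate i i<k h (inj₂ (inj₂ e)) with i <ᵇ l in lt
    ... | true  = inj₂ (there (here e))
    ... | false = inj₁ (trans e (only-≥ (suc i) (s≤s (<ᵇ-false lt))))

  candidates-unique : ∀ i → i < suc l → Unique (none ∷ candidates i)
  candidates-unique i i<k with i <ᵇ l in lt
  ... | true  = (none≢only i i<k ∷ none≢only (suc i) (s<s (<ᵇ-true lt)) ∷ [])
              ∷ ((λ e → 1+n≢n (sym (only-injective i (suc i) i<k e))) ∷ []) ∷ [] ∷ []
  ... | false = (none≢only i i<k ∷ []) ∷ [] ∷ []

  private
    staircase-continues : ∀ {d} i → i < suc l → ∀ {h} (x : Tuple n l) (hs : Vec (Vec Bool (suc l)) d) ch →
      h ∈ candidates i → Staircase none (candidates i) hs →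
      leqNextB (prepend h x) (zipWith prepend hs ch) ≡ true → hs ≡ replicate d h
    staircase-continues i i<k x [] [] h∈ [] _ = refl
    staircase-continues i i<k {h} x (_ ∷ hs) (y ∷ ch) h∈ (z∷ _) h≤ with candidate-only i i<k h∈
    ... | j , j<k , refl = ⊥-elim (false≢true (trans (sym (leqBits-only-none j j<k))
                             (∧-trueˡ (leqBits {suc l} (only j) none) (trans (sym (leqB-prepend (only j) none x y)) h≤))))
    staircase-continues i i<k {h} x (h′ ∷ hs) (y ∷ ch) h∈ (flat h′∈) h≤ =
      cong (λ h″ → replicate _ h″) (sym (candidates-comparable i i<k h∈ h′∈
        (∧-trueˡ (leqBits h h′) (trans (sym (leqB-prepend h h′ x y)) h≤))))

  chainB-staircase : ∀ {d} i t (us : Vec ℕ d) (ch : Vec (Tuple n l) d) hs → i < suc l →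
    chainB i t us (zipWith prepend hs ch) ≡ true → Staircase none (candidates i) hs
  chainB-staircase i t []       []       []       _   _  = []
  chainB-staircase i t (u ∷ us) (x ∷ ch) (h ∷ hs) i<k ok
    with shape-candidate i i<k h
           (completesB-prepend-shape i (t ≡ᵇ 0) x h (∧-trueˡ (completesB i (t ≡ᵇ 0) (prepend h x)) ok))
  ... | inj₁ refl =
    z∷ chainB-staircase i (pred t) us ch hs i<k (∧-trueʳ (leqNextB (prepend none x) (zipWith prepend hs ch)) rest)
    where rest = ∧-trueʳ (size (prepend none x) ≡ᵇ u) (∧-trueʳ (completesB i (t ≡ᵇ 0) (prepend none x)) ok)
  ... | inj₂ h∈ = subst (λ hs′ → Staircase none (candidates i) (h ∷ hs′))
      (sym (staircase-continues i i<k x hs ch h∈ tail-staircase (∧-trueˡ (leqNextB (prepend h x) (zipWith prepend hs ch)) rest)))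
      (flat h∈)
    where
    rest = ∧-trueʳ (size (prepend h x) ≡ᵇ u) (∧-trueʳ (completesB i (t ≡ᵇ 0) (prepend h x)) ok)
    tail-staircase = chainB-staircase i (pred t) us ch hs i<k (∧-trueʳ (leqNextB (prepend h x) (zipWith prepend hs ch)) rest)

  -- Along a chain the new least element is absent up to some position p and from p on lies in
  -- block i, or in block i + 1, which requires block i to meet the left part at position 0.
  completions-suc : ∀ {d} i t (us : Vec ℕ d) → i < suc l →
    completions (suc n) l i t us ≡
    completions n l i t us +
    ∑< d (λ p → ⟦ positiveFromB p us ⟧ * completions n l i (t ⊓ p) (decrementFrom p us)
               + ⟦ i <ᵇ l ⟧ * (⟦ positiveFromB p us ∧ (t ≡ᵇ 0) ⟧ * completions n l (suc i) p (decrementFrom p us)))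
  completions-suc {d} i t us i<k = begin
      completions (suc n) l i t us
    ≡⟨ ∑-chains-suc n l d (λ ch → ⟦ chainB i t us ch ⟧) ⟩
      ∑ (allVecs (allVecs booleans (suc l)) d) F
    ≡⟨ ∑-staircases (≡-dec Data.Bool._≟_) (allVecs-enumerates booleans-enumerates (suc l))
                    (candidates-unique i i<k) d F F-support ⟩
      F (replicate d none) + ∑< d (λ p → ∑ (candidates i) (λ k → F (staircase p none k)))
    ≡⟨ cong₂ _+_ (∑-cong Chains (λ ch → cong ⟦_⟧ (chainB-none i t us ch)))
                 (∑<-cong d (λ p p<d → trans (∑-candidates i _) (cong₂ _+_ (enter-current p) (enter-next p p<d)))) ⟩
      completions n l i t us +
      ∑< d (λ p → ⟦ positiveFromB p us ⟧ * completions n l i (t ⊓ p) (decrementFrom p us)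
                 + ⟦ i <ᵇ l ⟧ * (⟦ positiveFromB p us ∧ (t ≡ᵇ 0) ⟧ * completions n l (suc i) p (decrementFrom p us)))
    ∎
    where
    open ≡-Reasoning
    Chains = allVecs (tuples n l) d
    F : Vec (Vec Bool (suc l)) d → ℕ
    F hs = ∑ Chains (λ ch → ⟦ chainB i t us (zipWith prepend hs ch) ⟧)
    F-support : ∀ hs → F hs ≢ 0 → Staircase none (candidates i) hs
    F-support hs F≢0 = let ch , _ , ok = ∑≢0⇒∃ Chains _ F≢0 in chainB-staircase i t us ch hs i<k (⟦⟧≢0 ok)
    enter-current : ∀ p →
      F (staircase p none (only i)) ≡ ⟦ positiveFromB p us ⟧ * completions n l i (t ⊓ p) (decrementFrom p us)
    enter-current p = trans (∑-cong Chains (λ ch → cong ⟦_⟧ (chainB-staircase-only i t p us ch i<k)))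
                            (∑-⟦∧⟧ Chains (positiveFromB p us) _)
    enter-next : ∀ p → p < d →
      ⟦ i <ᵇ l ⟧ * F (staircase p none (only (suc i))) ≡
      ⟦ i <ᵇ l ⟧ * (⟦ positiveFromB p us ∧ (t ≡ᵇ 0) ⟧ * completions n l (suc i) p (decrementFrom p us))
    enter-next p p<d with i <ᵇ l in lt
    ... | false = refl
    ... | true  = cong (1 *_) (trans (∑-cong Chains (λ ch → cong ⟦_⟧
                    (trans (chainB-staircase-only-next i t p us ch (s<s (<ᵇ-true lt)) p<d)
                           (sym (∧-assoc (positiveFromB p us) (t ≡ᵇ 0) _)))))
                    (∑-⟦∧⟧ Chains (positiveFromB p us ∧ (t ≡ᵇ 0)) _))

-- The closed form

_choose_ : ℕ → ℕ → ℕ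
n     choose zero  = 1
zero  choose suc k = 0
suc n choose suc k = n choose k + n choose suc k

choose-> : ∀ n k → n < k → n choose k ≡ 0
choose-> zero    (suc k) _         = refl
choose-> (suc n) (suc k) (s<s n<k) = cong₂ _+_ (choose-> n k n<k) (choose-> n (suc k) (m<n⇒m<1+n n<k))

choose-diag : ∀ n → n choose n ≡ 1
choose-diag zero    = refl
choose-diag (suc n) = cong₂ _+_ (choose-diag n) (choose-> n (suc n) (n<1+n n))

choose≡C : ∀ n k → n choose k ≡ n C k
choose≡C n       zero    = refl
choose≡C zero    (suc k) = refl
choose≡C (suc n) (suc k) = trans (cong₂ _+_ (choose≡C n k) (choose≡C n (suc k))) (nCk+nC[k+1]≡[n+1]C[k+1] n k)

-- Compositions of c into b + 1 parts, all positive except possibly the first when s holds.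
compositions : Bool → ℕ → ℕ → ℕ
compositions true  c       b = c choose b
compositions false zero    b = 0
compositions false (suc c) b = c choose b

-- The c elements of the first chain member distributed over the current block and the b
-- blocks after it, and T further elements interleaved with them block by block.
weight : ℕ → Bool → ℕ → ℕ → ℕ
weight b s c T = compositions s c b * ((c + T + b) choose T)

weightFirst : ℕ → Bool → ℕ → ℕ → ℕ
weightFirst b s zero    T = 0
weightFirst b s (suc c) T = weight b true c T + ⟦ 0 <ᵇ b ⟧ * (⟦ s ⟧ * weight (pred b) true c T)

weightLater : ℕ → Bool → ℕ → ℕ → ℕ
weightLater b s c zero    = 0
weightLater b s c (suc T) = weight b s c T + ⟦ 0 <ᵇ b ⟧ * (⟦ s ⟧ * weight (pred b) false c T)

-- Pascal's rule, split by whether the least element lies in the first chain member or not.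
weight-split : ∀ b s c T → 0 < c + T → weight b s c T ≡ weightFirst b s c T + weightLater b s c T
weight-split zero    false zero    (suc T) _ = refl
weight-split (suc b) false zero    (suc T) _ = refl
weight-split zero    true  zero    (suc T) _ = begin
    1 * ((suc T + 0) choose suc T)   ≡⟨ cong (λ m → 1 * (m choose suc T)) (+-identityʳ (suc T)) ⟩
    1 * (suc T choose suc T)         ≡⟨ cong (1 *_) (choose-diag (suc T)) ⟩
    1                                ≡⟨ cong (λ m → 1 * m + 0) (sym (trans (cong (_choose T) (+-identityʳ T)) (choose-diag T))) ⟩
    1 * ((T + 0) choose T) + 0       ∎
  where open ≡-Reasoning
weight-split (suc b) true  zero    (suc T) _ = refl
weight-split zero    false (suc a) zero    _ = refl
weight-split (suc b) false (suc a) zero    _ = sym (trans (+-identityʳ _) (+-identityʳ _))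
weight-split zero    true  (suc a) zero    _ = refl
weight-split (suc b) true  (suc a) zero    _ = pascal (a choose b) (a choose suc b)
  where
  pascal : ∀ x y → (x + y) * 1 ≡ y * 1 + 1 * (1 * (x * 1)) + 0
  pascal = solve-∀
weight-split zero s (suc a) (suc T) _ =
  trans (cong (λ m → compositions s (suc a) 0 * (m choose suc T)) (shift a T))
    (trans (pascal (compositions s (suc a) 0) (one s) ((suc (a + T)) choose T) ((suc (a + T)) choose suc T))
      (sym (cong₂ (λ m m′ → (1 * (m choose suc T) + 0) + (compositions s (suc a) 0 * (m′ choose T) + 0))
                  (shiftˡ a T) (shiftʳ a T))))
  where
  one : ∀ s → compositions s (suc a) 0 ≡ 1
  one true  = refl
  one false = refl
  shift : ∀ a T → suc a + suc T + 0 ≡ suc (suc (a + T))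
  shift = solve-∀
  shiftˡ : ∀ a T → a + suc T + 0 ≡ suc (a + T)
  shiftˡ = solve-∀
  shiftʳ : ∀ a T → suc a + T + 0 ≡ suc (a + T)
  shiftʳ = solve-∀
  pascal : ∀ z → z ≡ 1 → ∀ x y → z * (x + y) ≡ (1 * y + 0) + (z * x + 0)
  pascal z refl = solve-∀
weight-split (suc b) false (suc a) (suc T) _ =
  trans (cong (λ m → (a choose suc b) * (m choose suc T)) (shift a T b))
    (trans (pascal (a choose suc b) ((suc (suc N)) choose T) ((suc (suc N)) choose suc T))
      (sym (cong₂ (λ m m′ → ((a choose suc b) * (m choose suc T) + 0) + ((a choose suc b) * (m′ choose T) + 0))
                  (shiftˡ a T b) (shiftʳ a T b))))
  where
  N = a + T + b
  shift : ∀ a T b → suc a + suc T + suc b ≡ suc (suc (suc (a + T + b)))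
  shift = solve-∀
  shiftˡ : ∀ a T b → a + suc T + suc b ≡ suc (suc (a + T + b))
  shiftˡ = solve-∀
  shiftʳ : ∀ a T b → suc a + T + suc b ≡ suc (suc (a + T + b))
  shiftʳ = solve-∀
  pascal : ∀ A x y → A * (x + y) ≡ (A * y + 0) + (A * x + 0)
  pascal = solve-∀
weight-split (suc b) true (suc a) (suc T) _ =
  trans (cong (λ m → ((a choose b) + (a choose suc b)) * (m choose suc T)) (shift a T b))
    (trans (pascal (a choose b) (a choose suc b) ((suc (suc N)) choose T) ((suc N) choose T) (N choose T) (N choose suc T))
      (sym (trans
        (cong₂ (λ m m′ → ((a choose suc b) * (m choose suc T) + 1 * (1 * ((a choose b) * (m′ choose suc T))))
                        + (((a choose b) + (a choose suc b)) * ((suc a + T + suc b) choose T) + 1 * (1 * ((a choose b) * ((suc a + T + b) choose T)))))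
               (shiftˡ a T b) (shiftˡ′ a T b))
        (cong₂ (λ m m′ → ((a choose suc b) * ((suc (suc N)) choose suc T) + 1 * (1 * ((a choose b) * ((suc N) choose suc T))))
                        + (((a choose b) + (a choose suc b)) * (m choose T) + 1 * (1 * ((a choose b) * (m′ choose T)))))
               (shiftʳ a T b) (shiftʳ′ a T b)))))
  where
  N = a + T + b
  shift : ∀ a T b → suc a + suc T + suc b ≡ suc (suc (suc (a + T + b)))
  shift = solve-∀
  shiftˡ : ∀ a T b → a + suc T + suc b ≡ suc (suc (a + T + b))
  shiftˡ = solve-∀
  shiftʳ : ∀ a T b → suc a + T + suc b ≡ suc (suc (a + T + b))
  shiftʳ = solve-∀
  shiftˡ′ : ∀ a T b → a + suc T + b ≡ suc (a + T + b)
  shiftˡ′ = solve-∀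
  shiftʳ′ : ∀ a T b → suc a + T + b ≡ suc (a + T + b)
  shiftʳ′ = solve-∀
  pascal : ∀ B A W X Y₁ Y₂ → (B + A) * (W + (X + (Y₁ + Y₂))) ≡
    (A * (X + (Y₁ + Y₂)) + 1 * (1 * (B * (Y₁ + Y₂)))) + ((B + A) * W + 1 * (1 * (B * X)))
  pascal = solve-∀

choose-pascal : ∀ n N → 0 < N → suc n choose N ≡ n choose N + n choose pred N
choose-pascal n (suc N) _ = +-comm (n choose N) (n choose suc N)

weight-pascal : ∀ n b s c T M → 0 < c + T →
  (suc n choose (c + T)) * (weight b s c T * M) ≡
  (n choose (c + T)) * (weight b s c T * M) + (n choose pred (c + T)) * ((weightFirst b s c T + weightLater b s c T) * M)
weight-pascal n b s c T M pos = begin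
    (suc n choose (c + T)) * (weight b s c T * M)
  ≡⟨ cong (_* (weight b s c T * M)) (choose-pascal n (c + T) pos) ⟩
    ((n choose (c + T)) + (n choose pred (c + T))) * (weight b s c T * M)
  ≡⟨ *-distribʳ-+ (weight b s c T * M) (n choose (c + T)) _ ⟩
    (n choose (c + T)) * (weight b s c T * M) + (n choose pred (c + T)) * (weight b s c T * M)
  ≡⟨ cong (λ w → (n choose (c + T)) * (weight b s c T * M) + (n choose pred (c + T)) * (w * M)) (weight-split b s c T pos) ⟩
    (n choose (c + T)) * (weight b s c T * M) + (n choose pred (c + T)) * ((weightFirst b s c T + weightLater b s c T) * M)
  ∎
  where open ≡-Reasoning

multinomialᵥ : ∀ {d} → Vec ℕ d → ℕ
multinomialᵥ []       = 1
multinomialᵥ (c ∷ cs) = ((c + Vec.sum cs) choose c) * multinomialᵥ cs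

decrementAt : ∀ {d} → ℕ → Vec ℕ d → Maybe (Vec ℕ d)
decrementAt p       []           = nothing
decrementAt zero    (zero ∷ cs)  = nothing
decrementAt zero    (suc c ∷ cs) = just (c ∷ cs)
decrementAt (suc p) (c ∷ cs)     = Maybe.map (c ∷_) (decrementAt p cs)

decrementAt-sum : ∀ {d} p (c c′ : Vec ℕ d) → decrementAt p c ≡ just c′ → suc (Vec.sum c′) ≡ Vec.sum c
decrementAt-sum zero    (suc c ∷ cs) _ refl = refl
decrementAt-sum (suc p) (c ∷ cs)     _ e with decrementAt p cs in eq
decrementAt-sum (suc p) (c ∷ cs)     _ refl | just cs′ =
  trans (sym (+-suc c (Vec.sum cs′))) (cong (c +_) (decrementAt-sum p cs cs′ eq))

multinomial-pascal : ∀ {d} (cs : Vec ℕ d) →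
  ∑< d (λ q → ∑ᵐ (decrementAt q cs) multinomialᵥ) ≡ ⟦ 0 <ᵇ Vec.sum cs ⟧ * multinomialᵥ cs
multinomial-pascal []       = refl
multinomial-pascal {suc d} (c ∷ cs) = begin
    ∑ᵐ (decrementAt 0 (c ∷ cs)) multinomialᵥ + ∑< d (λ q → ∑ᵐ (decrementAt (suc q) (c ∷ cs)) multinomialᵥ)
  ≡⟨ cong (∑ᵐ (decrementAt 0 (c ∷ cs)) multinomialᵥ +_)
          (trans (∑<-cong d (λ q _ → lower-later q)) (∑<-*ˡ d B (λ q → ∑ᵐ (decrementAt q cs) multinomialᵥ))) ⟩
    ∑ᵐ (decrementAt 0 (c ∷ cs)) multinomialᵥ + B * ∑< d (λ q → ∑ᵐ (decrementAt q cs) multinomialᵥ)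
  ≡⟨ cong (λ m → ∑ᵐ (decrementAt 0 (c ∷ cs)) multinomialᵥ + B * m) (multinomial-pascal cs) ⟩
    ∑ᵐ (decrementAt 0 (c ∷ cs)) multinomialᵥ + B * (⟦ 0 <ᵇ S ⟧ * M)
  ≡⟨ cong (_+ B * (⟦ 0 <ᵇ S ⟧ * M)) (lower-first c) ⟩
    first c S + B * (⟦ 0 <ᵇ S ⟧ * M)
  ≡⟨ pascal c S ⟩
    ⟦ 0 <ᵇ c + S ⟧ * (((c + S) choose c) * M)
  ∎
  where
  open ≡-Reasoning
  S = Vec.sum cs
  M = multinomialᵥ cs
  B = (c + pred S) choose c
  lower-later : ∀ q → ∑ᵐ (decrementAt (suc q) (c ∷ cs)) multinomialᵥ ≡ B * ∑ᵐ (decrementAt q cs) multinomialᵥ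
  lower-later q = trans (∑ᵐ-map (c ∷_) (decrementAt q cs) multinomialᵥ)
    (trans (∑ᵐ-cong (decrementAt q cs) (λ cs′ e →
              cong (λ m → ((c + m) choose c) * multinomialᵥ cs′) (cong pred (decrementAt-sum q cs cs′ e))))
           (∑ᵐ-*ˡ (decrementAt q cs) B multinomialᵥ))
  first : ℕ → ℕ → ℕ
  first zero    S = 0
  first (suc c) S = ((c + S) choose c) * M
  lower-first : ∀ c → ∑ᵐ (decrementAt 0 (c ∷ cs)) multinomialᵥ ≡ first c S
  lower-first zero    = refl
  lower-first (suc c) = refl
  pascal : ∀ c S → first c S + ((c + pred S) choose c) * (⟦ 0 <ᵇ S ⟧ * M) ≡ ⟦ 0 <ᵇ c + S ⟧ * (((c + S) choose c) * M)
  pascal zero    zero    = refl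
  pascal zero    (suc S) = unit M
    where
    unit : ∀ M → 0 + 1 * (1 * M) ≡ 1 * (1 * M)
    unit = solve-∀
  pascal (suc c) zero rewrite +-identityʳ c | choose-diag c | choose-> c (suc c) (n<1+n c) = unit M
    where
    unit : ∀ M → 1 * M + (1 + 0) * 0 ≡ 1 * ((1 + 0) * M)
    unit = solve-∀
  pascal (suc c) (suc S) rewrite +-suc c S = split (suc (c + S) choose c) ((c + S) choose c) ((c + S) choose suc c) M
    where
    split : ∀ X Y₁ Y₂ M → X * M + (Y₁ + Y₂) * (M + 0) ≡ (X + (Y₁ + Y₂)) * M + 0
    split = solve-∀

-- The first entry is the size of the first chain member, the others are the gaps between
-- consecutive sizes; b blocks follow the current one, whose state is s.
closedForm : ℕ → ℕ → Bool → ∀ {d} → Vec ℕ (suc d) → ℕ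
closedForm n b s (c ∷ cs) = (n choose (c + Vec.sum cs)) * (weight b s c (Vec.sum cs) * multinomialᵥ cs)

closedForm-pascal : ∀ n b s c T M →
  (suc n choose (c + T)) * (weight b s c T * M) ≡
  (n choose (c + T)) * (weight b s c T * M) + (n choose pred (c + T)) * ((weightFirst b s c T + weightLater b s c T) * M)
closedForm-pascal n b s zero    zero    M = sym (+-identityʳ _)
closedForm-pascal n b s zero    (suc T) M = weight-pascal n b s zero (suc T) M z<s
closedForm-pascal n b s (suc c) T       M = weight-pascal n b s (suc c) T M z<s

closedForm-lower-first : ∀ n b s {d} c (cs : Vec ℕ d) →
  ∑ᵐ (decrementAt 0 (c ∷ cs)) (closedForm n b (s ∨ true)) +
  ⟦ 0 <ᵇ b ⟧ * (⟦ s ⟧ * ∑ᵐ (decrementAt 0 (c ∷ cs)) (closedForm n (pred b) true))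
  ≡ (n choose pred (c + Vec.sum cs)) * (weightFirst b s c (Vec.sum cs) * multinomialᵥ cs)
closedForm-lower-first n b s zero    cs = regroup ⟦ 0 <ᵇ b ⟧ ⟦ s ⟧ (n choose pred (Vec.sum cs)) (multinomialᵥ cs)
  where
  regroup : ∀ x y z M → 0 + x * (y * 0) ≡ z * (0 * M)
  regroup = solve-∀
closedForm-lower-first n b s (suc a) cs rewrite ∨-zeroʳ s =
  regroup (n choose (a + S)) (weight b true a S) (multinomialᵥ cs) ⟦ 0 <ᵇ b ⟧ ⟦ s ⟧ (weight (pred b) true a S)
  where
  S = Vec.sum cs
  regroup : ∀ C W M x y W′ → C * (W * M) + x * (y * (C * (W′ * M))) ≡ C * ((W + x * (y * W′)) * M)
  regroup = solve-∀

closedForm-lower-later : ∀ n b s {d} c (cs : Vec ℕ d) →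
  ∑< d (λ q → ∑ᵐ (decrementAt (suc q) (c ∷ cs)) (closedForm n b (s ∨ false)) +
              ⟦ 0 <ᵇ b ⟧ * (⟦ s ⟧ * ∑ᵐ (decrementAt (suc q) (c ∷ cs)) (closedForm n (pred b) false)))
  ≡ (n choose pred (c + Vec.sum cs)) * (weightLater b s c (Vec.sum cs) * multinomialᵥ cs)
closedForm-lower-later n b s {d} c cs = begin
    ∑< d (λ q → ∑ᵐ (decrementAt (suc q) (c ∷ cs)) (closedForm n b (s ∨ false)) +
                ⟦ 0 <ᵇ b ⟧ * (⟦ s ⟧ * ∑ᵐ (decrementAt (suc q) (c ∷ cs)) (closedForm n (pred b) false)))
  ≡⟨ ∑<-cong d (λ q _ → lower q) ⟩
    ∑< d (λ q → K * ∑ᵐ (decrementAt q cs) multinomialᵥ)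
  ≡⟨ ∑<-*ˡ d K _ ⟩
    K * ∑< d (λ q → ∑ᵐ (decrementAt q cs) multinomialᵥ)
  ≡⟨ cong (K *_) (multinomial-pascal cs) ⟩
    K * (⟦ 0 <ᵇ S ⟧ * M)
  ≡⟨ later S ⟩
    (n choose pred (c + S)) * (weightLater b s c S * M)
  ∎
  where
  open ≡-Reasoning
  S = Vec.sum cs
  M = multinomialᵥ cs
  K = (n choose (c + pred S)) * (weight b s c (pred S) + ⟦ 0 <ᵇ b ⟧ * (⟦ s ⟧ * weight (pred b) false c (pred S)))
  lowered : ∀ s′ b′ q cs′ → decrementAt q cs ≡ just cs′ →
    closedForm n b′ s′ (c ∷ cs′) ≡ ((n choose (c + pred S)) * weight b′ s′ c (pred S)) * multinomialᵥ cs′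
  lowered s′ b′ q cs′ e rewrite sym (cong pred (decrementAt-sum q cs cs′ e)) =
    sym (*-assoc (n choose (c + Vec.sum cs′)) (weight b′ s′ c (Vec.sum cs′)) (multinomialᵥ cs′))
  lower : ∀ q → ∑ᵐ (decrementAt (suc q) (c ∷ cs)) (closedForm n b (s ∨ false)) +
                ⟦ 0 <ᵇ b ⟧ * (⟦ s ⟧ * ∑ᵐ (decrementAt (suc q) (c ∷ cs)) (closedForm n (pred b) false))
              ≡ K * ∑ᵐ (decrementAt q cs) multinomialᵥ
  lower q rewrite ∨-identityʳ s
    | ∑ᵐ-map (c ∷_) (decrementAt q cs) (closedForm n b s)
    | ∑ᵐ-map (c ∷_) (decrementAt q cs) (closedForm n (pred b) false)
    | ∑ᵐ-cong (decrementAt q cs) (lowered s b q)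
    | ∑ᵐ-cong (decrementAt q cs) (lowered false (pred b) q)
    | ∑ᵐ-*ˡ (decrementAt q cs) ((n choose (c + pred S)) * weight b s c (pred S)) multinomialᵥ
    | ∑ᵐ-*ˡ (decrementAt q cs) ((n choose (c + pred S)) * weight (pred b) false c (pred S)) multinomialᵥ =
    regroup (n choose (c + pred S)) (weight b s c (pred S)) (weight (pred b) false c (pred S)) ⟦ 0 <ᵇ b ⟧ ⟦ s ⟧
            (∑ᵐ (decrementAt q cs) multinomialᵥ)
    where
    regroup : ∀ C W W′ x y m → C * W * m + x * (y * (C * W′ * m)) ≡ C * (W + x * (y * W′)) * m
    regroup = solve-∀
  later : ∀ S →
    (n choose (c + pred S)) * (weight b s c (pred S) + ⟦ 0 <ᵇ b ⟧ * (⟦ s ⟧ * weight (pred b) false c (pred S)))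
      * (⟦ 0 <ᵇ S ⟧ * M)
                ≡ (n choose pred (c + S)) * (weightLater b s c S * M)
  later zero    = trans (*-zeroʳ ((n choose (c + 0)) * (weight b s c 0 + ⟦ 0 <ᵇ b ⟧ * (⟦ s ⟧ * weight (pred b) false c 0))))
                        (sym (*-zeroʳ (n choose pred (c + 0))))
  later (suc S) rewrite +-suc c S =
    regroup (n choose (c + S)) (weight b s c S + ⟦ 0 <ᵇ b ⟧ * (⟦ s ⟧ * weight (pred b) false c S)) M
    where
    regroup : ∀ C W M → C * W * (1 * M) ≡ C * (W * M)
    regroup = solve-∀

closedForm-suc : ∀ n b s {d} c (cs : Vec ℕ d) →
  closedForm (suc n) b s (c ∷ cs) ≡
  closedForm n b s (c ∷ cs) +
  ∑< (suc d) (λ p → ∑ᵐ (decrementAt p (c ∷ cs)) (closedForm n b (s ∨ (p ≡ᵇ 0))) +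
                    ⟦ 0 <ᵇ b ⟧ * (⟦ s ⟧ * ∑ᵐ (decrementAt p (c ∷ cs)) (closedForm n (pred b) (p ≡ᵇ 0))))
closedForm-suc n b s c cs = begin
    (suc n choose (c + S)) * (weight b s c S * M)
  ≡⟨ closedForm-pascal n b s c S M ⟩
    (n choose (c + S)) * (weight b s c S * M) + (n choose pred (c + S)) * ((weightFirst b s c S + weightLater b s c S) * M)
  ≡⟨ cong ((n choose (c + S)) * (weight b s c S * M) +_)
          (distrib (n choose pred (c + S)) (weightFirst b s c S) (weightLater b s c S) M) ⟩
    (n choose (c + S)) * (weight b s c S * M) +
    ((n choose pred (c + S)) * (weightFirst b s c S * M) + (n choose pred (c + S)) * (weightLater b s c S * M))
  ≡⟨ cong ((n choose (c + S)) * (weight b s c S * M) +_)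
          (sym (cong₂ _+_ (closedForm-lower-first n b s c cs) (closedForm-lower-later n b s c cs))) ⟩
    closedForm n b s (c ∷ cs) + _
  ∎
  where
  open ≡-Reasoning
  S = Vec.sum cs
  M = multinomialᵥ cs
  distrib : ∀ C x y M → C * ((x + y) * M) ≡ C * (x * M) + C * (y * M)
  distrib = solve-∀

-- Induction on n

partialSums : ∀ {d} → ℕ → Vec ℕ d → Vec ℕ d
partialSums a []       = []
partialSums a (c ∷ cs) = (a + c) ∷ partialSums (a + c) cs

positiveFromB-partialSums : ∀ {d} a (cs : Vec ℕ d) → positiveFromB 0 (partialSums (suc a) cs) ≡ true
positiveFromB-partialSums a []       = refl
positiveFromB-partialSums a (c ∷ cs) = positiveFromB-partialSums (a + c) cs

pred-partialSums : ∀ {d} a (cs : Vec ℕ d) → Vec.map pred (partialSums (suc a) cs) ≡ partialSums a cs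
pred-partialSums a []       = refl
pred-partialSums a (c ∷ cs) = cong ((a + c) ∷_) (pred-partialSums (a + c) cs)

decrementAt-partialSums : ∀ {d} p a (c c′ : Vec ℕ d) → decrementAt p c ≡ just c′ →
  positiveFromB p (partialSums a c) ≡ true × decrementFrom p (partialSums a c) ≡ partialSums a c′
decrementAt-partialSums zero a (suc c ∷ cs) _ refl rewrite +-suc a c =
  positiveFromB-partialSums (a + c) cs , cong ((a + c) ∷_) (pred-partialSums (a + c) cs)
decrementAt-partialSums (suc p) a (c ∷ cs) _ e with decrementAt p cs in eq
decrementAt-partialSums (suc p) a (c ∷ cs) _ refl | just cs′ =
  let pos , dec = decrementAt-partialSums p (a + c) cs cs′ eq in pos , cong ((a + c) ∷_) dec

-- Lowering a zero gap would make the sizes decrease, which no chain allows.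
decrementAt-unsorted : ∀ {d} q (c : Vec ℕ d) a → decrementAt (suc q) c ≡ nothing → suc q < d →
  positiveFromB (suc q) (partialSums a c) ≡ true → ¬ Linked _≤_ (toList (decrementFrom (suc q) (partialSums a c)))
decrementAt-unsorted q (c₀ ∷ cs) a none q<d pos sorted with decrementAt q cs in eq
decrementAt-unsorted zero (c₀ ∷ [])          a _ (s<s ()) _ _ | nothing
decrementAt-unsorted zero (c₀ ∷ zero ∷ cs)   a _ _ pos (m≤m-1 ∷ _) | nothing =
  stuck (a + c₀) (∧-trueˡ (0 <ᵇ a + c₀ + 0) pos) m≤m-1
  where
  stuck : ∀ m → (0 <ᵇ m + 0) ≡ true → m ≤ pred (m + 0) → ⊥
  stuck m pos′ le rewrite +-identityʳ m with m
  ... | suc m′ = 1+n≰n le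
decrementAt-unsorted (suc q) (c₀ ∷ cs) a _ (s<s q<d) pos sorted | nothing =
  decrementAt-unsorted q cs (a + c₀) eq q<d pos (Linked.tail sorted)

completions-unsorted : ∀ n l i t {d} (us : Vec ℕ d) → ¬ Linked _≤_ (toList us) → completions n l i t us ≡ 0
completions-unsorted n l i t {d} us unsorted = ∑-zero (allVecs (tuples n l) d) vanish
  where
  vanish : ∀ ch → ⟦ chainB i t us ch ⟧ ≡ 0
  vanish ch with chainB i t us ch in ok
  ... | true  = ⊥-elim (unsorted (chainB-sorted i t us ch ok))
  ... | false = refl

completions-decrementFrom : ∀ n l j t′ {d} p (c : Vec ℕ d) → p < d →
  ⟦ positiveFromB p (partialSums 0 c) ⟧ * completions n l j t′ (decrementFrom p (partialSums 0 c)) ≡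
  ∑ᵐ (decrementAt p c) (λ c′ → completions n l j t′ (partialSums 0 c′))
completions-decrementFrom n l j t′ p c p<d with decrementAt p c in eq
... | just c′ with decrementAt-partialSums p 0 c c′ eq
...   | positive , lowered rewrite positive | lowered = +-identityʳ _
completions-decrementFrom n l j t′ zero    (zero ∷ cs) p<d | nothing = refl
completions-decrementFrom n l j t′ (suc q) c           p<d | nothing with positiveFromB (suc q) (partialSums 0 c) in pos
... | false = refl
... | true  = trans (+-identityʳ _) (completions-unsorted n l j t′ _ (decrementAt-unsorted q c 0 eq p<d pos))

recurrence : ∀ {d} → (ℕ → ℕ → Vec ℕ (suc d) → ℕ) → ℕ → ℕ → ℕ → Vec ℕ (suc d) → ℕ
recurrence {d} f l i t c =
  f i t c + ∑< (suc d) (λ p → ∑ᵐ (decrementAt p c) (f i (t ⊓ p)) +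
                              ⟦ i <ᵇ l ⟧ * (⟦ t ≡ᵇ 0 ⟧ * ∑ᵐ (decrementAt p c) (f (suc i) p)))

recurrence-cong : ∀ {d} {f g : ℕ → ℕ → Vec ℕ (suc d) → ℕ} → (∀ i t c → f i t c ≡ g i t c) →
  ∀ l i t c → recurrence f l i t c ≡ recurrence g l i t c
recurrence-cong {d} f≡g l i t c = cong₂ _+_ (f≡g i t c) (∑<-cong (suc d) (λ p _ →
  cong₂ _+_ (∑ᵐ-cong (decrementAt p c) (λ c′ _ → f≡g i (t ⊓ p) c′))
            (cong (λ x → ⟦ i <ᵇ l ⟧ * (⟦ t ≡ᵇ 0 ⟧ * x)) (∑ᵐ-cong (decrementAt p c) (λ c′ _ → f≡g (suc i) p c′)))))

completions-suc-gaps : ∀ n l i t {d} (c : Vec ℕ (suc d)) → i < suc l →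
  completions (suc n) l i t (partialSums 0 c) ≡ recurrence (λ i t c → completions n l i t (partialSums 0 c)) l i t c
completions-suc-gaps n l i t {d} c i<k =
  trans (completions-suc {n} {l} i t (partialSums 0 c) i<k)
        (cong (completions n l i t (partialSums 0 c) +_) (∑<-cong (suc d) per-gap))
  where
  us = partialSums 0 c
  per-gap : ∀ p → p < suc d →
    ⟦ positiveFromB p us ⟧ * completions n l i (t ⊓ p) (decrementFrom p us) +
    ⟦ i <ᵇ l ⟧ * (⟦ positiveFromB p us ∧ (t ≡ᵇ 0) ⟧ * completions n l (suc i) p (decrementFrom p us)) ≡
    ∑ᵐ (decrementAt p c) (λ c′ → completions n l i (t ⊓ p) (partialSums 0 c′)) +
    ⟦ i <ᵇ l ⟧ * (⟦ t ≡ᵇ 0 ⟧ * ∑ᵐ (decrementAt p c) (λ c′ → completions n l (suc i) p (partialSums 0 c′)))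
  per-gap p p<d = cong₂ _+_ (completions-decrementFrom n l i (t ⊓ p) p c p<d)
    (cong (⟦ i <ᵇ l ⟧ *_) (begin
      ⟦ positiveFromB p us ∧ (t ≡ᵇ 0) ⟧ * completions n l (suc i) p (decrementFrom p us)
    ≡⟨ cong (_* completions n l (suc i) p (decrementFrom p us)) (⟦∧⟧ (positiveFromB p us) (t ≡ᵇ 0)) ⟩
      ⟦ positiveFromB p us ⟧ * ⟦ t ≡ᵇ 0 ⟧ * completions n l (suc i) p (decrementFrom p us)
    ≡⟨ x*y*z≡y*[x*z] ⟦ positiveFromB p us ⟧ ⟦ t ≡ᵇ 0 ⟧ _ ⟩
      ⟦ t ≡ᵇ 0 ⟧ * (⟦ positiveFromB p us ⟧ * completions n l (suc i) p (decrementFrom p us))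
    ≡⟨ cong (⟦ t ≡ᵇ 0 ⟧ *_) (completions-decrementFrom n l (suc i) p p c p<d) ⟩
      ⟦ t ≡ᵇ 0 ⟧ * ∑ᵐ (decrementAt p c) (λ c′ → completions n l (suc i) p (partialSums 0 c′))
    ∎))
    where
    open ≡-Reasoning
    x*y*z≡y*[x*z] : ∀ x y z → x * y * z ≡ y * (x * z)
    x*y*z≡y*[x*z] = solve-∀

closedFormAt : (n l : ℕ) {d : ℕ} → ℕ → ℕ → Vec ℕ (suc d) → ℕ
closedFormAt n l i t c = ⟦ i <ᵇ suc l ⟧ * closedForm n (l ∸ i) (t ≡ᵇ 0) c

emptyTuple : ∀ l → Tuple 0 l
emptyTuple l = replicate (suc l) []

allVecs-singleton : ∀ {A : Set} (v : A) k → allVecs [ v ] k ≡ [ replicate k v ]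
allVecs-singleton v zero    = refl
allVecs-singleton v (suc k) rewrite allVecs-singleton v k = refl

completesB-emptyTuple : ∀ l i s → completesB i s (emptyTuple l) ≡ s ∧ (i ≡ᵇ l)
completesB-emptyTuple zero    zero    s = trans (∨-identityʳ s) (sym (∧-identityʳ s))
completesB-emptyTuple zero    (suc i) s = sym (∧-zeroʳ s)
completesB-emptyTuple (suc l) zero    s =
  trans (cong (λ c → (s ∨ false) ∧ (true ∧ c)) (completesB-emptyTuple l zero false))
        (trans (∧-zeroʳ (s ∨ false)) (sym (∧-zeroʳ s)))
completesB-emptyTuple (suc l) (suc i) s = completesB-emptyTuple l i s

leqB-emptyTuple : ∀ l → leqB (emptyTuple l) (emptyTuple l) ≡ true
leqB-emptyTuple zero    = refl
leqB-emptyTuple (suc l) = leqB-emptyTuple l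

allZeroB : ∀ {d} → Vec ℕ d → Bool
allZeroB []       = true
allZeroB (u ∷ us) = (0 ≡ᵇ u) ∧ allZeroB us

chainB-emptyTuple : ∀ l i t {d} u (us : Vec ℕ d) →
  chainB i t (u ∷ us) (replicate (suc d) (emptyTuple l)) ≡ (t ≡ᵇ 0) ∧ ((i ≡ᵇ l) ∧ allZeroB (u ∷ us))
chainB-emptyTuple l i t u [] rewrite completesB-emptyTuple l i (t ≡ᵇ 0) | size-0 (emptyTuple l) =
  regroup (t ≡ᵇ 0) (i ≡ᵇ l) (0 ≡ᵇ u)
  where
  regroup : ∀ s e z → (s ∧ e) ∧ (z ∧ (true ∧ true)) ≡ s ∧ (e ∧ (z ∧ true))
  regroup = solve-∀-with ∨-∧-ring
chainB-emptyTuple l i zero u (v ∷ us) =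
  trans (cong₂ (λ g r → g ∧ ((size (emptyTuple l) ≡ᵇ u) ∧ r)) (completesB-emptyTuple l i true)
               (cong₂ _∧_ (leqB-emptyTuple l) (chainB-emptyTuple l i zero v us)))
    (trans (cong (λ m → (true ∧ (i ≡ᵇ l)) ∧ ((m ≡ᵇ u) ∧ (true ∧ (true ∧ ((i ≡ᵇ l) ∧ allZeroB (v ∷ us))))))
                 (size-0 (emptyTuple l)))
           (regroup (i ≡ᵇ l) (0 ≡ᵇ u) (allZeroB (v ∷ us))))
  where
  regroup : ∀ e z a → (true ∧ e) ∧ (z ∧ (true ∧ (true ∧ (e ∧ a)))) ≡ true ∧ (e ∧ (z ∧ a))
  regroup true  z a = refl
  regroup false z a = refl
chainB-emptyTuple l i (suc t) u (v ∷ us) rewrite completesB-emptyTuple l i false = refl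

completions-zero : ∀ l i t {d} u (us : Vec ℕ d) →
  completions 0 l i t (u ∷ us) ≡ ⟦ (t ≡ᵇ 0) ∧ ((i ≡ᵇ l) ∧ allZeroB (u ∷ us)) ⟧
completions-zero l i t {d} u us rewrite allVecs-singleton {Subset 0} [] (suc l) | allVecs-singleton (emptyTuple l) (suc d) =
  trans (+-identityʳ _) (cong ⟦_⟧ (chainB-emptyTuple l i t u us))

allZeroB-partialSums : ∀ {d} (c : Vec ℕ d) → allZeroB (partialSums 0 c) ≡ (Vec.sum c ≡ᵇ 0)
allZeroB-partialSums []           = refl
allZeroB-partialSums (zero ∷ cs)  = allZeroB-partialSums cs
allZeroB-partialSums (suc c ∷ cs) = refl

multinomialᵥ-zero : ∀ {d} (cs : Vec ℕ d) → Vec.sum cs ≡ 0 → multinomialᵥ cs ≡ 1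
multinomialᵥ-zero []          _ = refl
multinomialᵥ-zero (zero ∷ cs) e = trans (+-identityʳ _) (multinomialᵥ-zero cs e)

closedForm-zero : ∀ b s {d} c (cs : Vec ℕ d) →
  closedForm 0 b s (c ∷ cs) ≡ ⟦ c + Vec.sum cs ≡ᵇ 0 ⟧ * ⟦ s ∧ (b ≡ᵇ 0) ⟧
closedForm-zero b s (suc c) cs = refl
closedForm-zero b s zero    cs with Vec.sum cs in S≡
... | suc _ = refl
... | zero  rewrite multinomialᵥ-zero cs S≡ = cong (1 *_) (trans (*-identityʳ (weight b s 0 0)) (weight-empty s b))
  where
  weight-empty : ∀ s b → weight b s 0 0 ≡ ⟦ s ∧ (b ≡ᵇ 0) ⟧
  weight-empty false b       = refl
  weight-empty true  zero    = refl
  weight-empty true  (suc b) = refl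

completions-base : ∀ l i t {d} (c : Vec ℕ (suc d)) → completions 0 l i t (partialSums 0 c) ≡ closedFormAt 0 l i t c
completions-base l i t (c ∷ cs) = begin
    completions 0 l i t (partialSums 0 (c ∷ cs))
  ≡⟨ completions-zero l i t c (partialSums c cs) ⟩
    ⟦ s ∧ ((i ≡ᵇ l) ∧ allZeroB (partialSums 0 (c ∷ cs))) ⟧
  ≡⟨ cong (λ z → ⟦ s ∧ ((i ≡ᵇ l) ∧ z) ⟧) (allZeroB-partialSums (c ∷ cs)) ⟩
    ⟦ s ∧ ((i ≡ᵇ l) ∧ z) ⟧
  ≡⟨ cong (λ e → ⟦ s ∧ (e ∧ z) ⟧) (sym (within-l i l)) ⟩
    ⟦ s ∧ (((i <ᵇ suc l) ∧ (l ∸ i ≡ᵇ 0)) ∧ z) ⟧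
  ≡⟨ cong ⟦_⟧ (regroup s (i <ᵇ suc l) (l ∸ i ≡ᵇ 0) z) ⟩
    ⟦ (i <ᵇ suc l) ∧ (z ∧ (s ∧ (l ∸ i ≡ᵇ 0))) ⟧
  ≡⟨ trans (⟦∧⟧ (i <ᵇ suc l) _) (cong (⟦ i <ᵇ suc l ⟧ *_) (⟦∧⟧ z _)) ⟩
    ⟦ i <ᵇ suc l ⟧ * (⟦ z ⟧ * ⟦ s ∧ (l ∸ i ≡ᵇ 0) ⟧)
  ≡⟨ cong (⟦ i <ᵇ suc l ⟧ *_) (sym (closedForm-zero (l ∸ i) s c cs)) ⟩
    ⟦ i <ᵇ suc l ⟧ * closedForm 0 (l ∸ i) s (c ∷ cs)
  ∎
  where
  open ≡-Reasoning
  s = t ≡ᵇ 0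
  z = c + Vec.sum cs ≡ᵇ 0
  within-l : ∀ i l → (i <ᵇ suc l) ∧ (l ∸ i ≡ᵇ 0) ≡ (i ≡ᵇ l)
  within-l zero    zero    = refl
  within-l zero    (suc l) = refl
  within-l (suc i) zero    = refl
  within-l (suc i) (suc l) = within-l i l
  regroup : ∀ s a f z → s ∧ ((a ∧ f) ∧ z) ≡ a ∧ (z ∧ (s ∧ f))
  regroup = solve-∀-with ∨-∧-ring

completions-≥ : ∀ n l i t {d} (us : Vec ℕ (suc d)) → suc l ≤ i → completions n l i t us ≡ 0
completions-≥ n l i t {d} (u ∷ us) l<i = ∑-zero (allVecs (tuples n l) (suc d)) vanish
  where
  vanish : ∀ ch → ⟦ chainB i t (u ∷ us) ch ⟧ ≡ 0
  vanish (x ∷ ch) rewrite completesB-≥ i (t ≡ᵇ 0) x l<i = refl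

closedFormAt-suc : ∀ n l i t {d} (c : Vec ℕ (suc d)) → i < suc l →
  recurrence (closedFormAt n l) l i t c ≡ closedFormAt (suc n) l i t c
closedFormAt-suc n l i t {d} c@(c₀ ∷ cs) i<k = begin
    recurrence (closedFormAt n l) l i t c
  ≡⟨ cong₂ _+_ (within i t c) (∑<-cong (suc d) (λ p _ → cong₂ _+_ (stay p) (advance p))) ⟩
    closedForm n b s c +
    ∑< (suc d) (λ p → ∑ᵐ (decrementAt p c) (closedForm n b (s ∨ (p ≡ᵇ 0))) +
                      ⟦ 0 <ᵇ b ⟧ * (⟦ s ⟧ * ∑ᵐ (decrementAt p c) (closedForm n (pred b) (p ≡ᵇ 0))))
  ≡⟨ sym (closedForm-suc n b s c₀ cs) ⟩
    closedForm (suc n) b s c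
  ≡⟨ sym (within {suc n} i t c) ⟩
    closedFormAt (suc n) l i t c
  ∎
  where
  open ≡-Reasoning
  b = l ∸ i
  s = t ≡ᵇ 0
  within : ∀ {n} i′ t′ (c′ : Vec ℕ (suc d)) →
    ⟦ i <ᵇ suc l ⟧ * closedForm n (l ∸ i′) (t′ ≡ᵇ 0) c′ ≡ closedForm n (l ∸ i′) (t′ ≡ᵇ 0) c′
  within i′ t′ c′ rewrite <⇒<ᵇ-true i<k = *-identityˡ _
  stay : ∀ p →
    ∑ᵐ (decrementAt p c) (closedFormAt n l i (t ⊓ p)) ≡ ∑ᵐ (decrementAt p c) (closedForm n b (s ∨ (p ≡ᵇ 0)))
  stay p = ∑ᵐ-cong (decrementAt p c) (λ c′ _ →
    trans (within i (t ⊓ p) c′) (cong (λ s′ → closedForm n b s′ c′) (⊓≡ᵇ0 t p)))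
    where
    ⊓≡ᵇ0 : ∀ t p → ((t ⊓ p) ≡ᵇ 0) ≡ (t ≡ᵇ 0) ∨ (p ≡ᵇ 0)
    ⊓≡ᵇ0 zero    p       = refl
    ⊓≡ᵇ0 (suc t) zero    = refl
    ⊓≡ᵇ0 (suc t) (suc p) = refl
  advance : ∀ p → ⟦ i <ᵇ l ⟧ * (⟦ s ⟧ * ∑ᵐ (decrementAt p c) (closedFormAt n l (suc i) p)) ≡
                  ⟦ 0 <ᵇ b ⟧ * (⟦ s ⟧ * ∑ᵐ (decrementAt p c) (closedForm n (pred b) (p ≡ᵇ 0)))
  advance p = trans (idempotent (i <ᵇ l))
    (cong₂ (λ x b′ → ⟦ x ⟧ * (⟦ s ⟧ * ∑ᵐ (decrementAt p c) (closedForm n b′ (p ≡ᵇ 0))))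
           (<ᵇ-∸ i l) (sym (pred[m∸n]≡m∸[1+n] l i)))
    where
    Y = closedForm n (l ∸ suc i) (p ≡ᵇ 0)
    idempotent : ∀ x →
      ⟦ x ⟧ * (⟦ s ⟧ * ∑ᵐ (decrementAt p c) (λ c′ → ⟦ x ⟧ * Y c′)) ≡ ⟦ x ⟧ * (⟦ s ⟧ * ∑ᵐ (decrementAt p c) Y)
    idempotent false = refl
    idempotent true  = cong (λ y → 1 * (⟦ s ⟧ * y)) (∑ᵐ-cong (decrementAt p c) (λ c′ _ → *-identityˡ (Y c′)))
    <ᵇ-∸ : ∀ i l → (i <ᵇ l) ≡ (0 <ᵇ l ∸ i)
    <ᵇ-∸ zero    l       = refl
    <ᵇ-∸ (suc i) zero    = refl
    <ᵇ-∸ (suc i) (suc l) = <ᵇ-∸ i l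

completions≡closedFormAt : ∀ n l i t {d} (c : Vec ℕ (suc d)) → completions n l i t (partialSums 0 c) ≡ closedFormAt n l i t c
completions≡closedFormAt zero    l i t c = completions-base l i t c
completions≡closedFormAt (suc n) l i t c with i <ᵇ suc l in i≤l
... | false = completions-≥ (suc n) l i t (partialSums 0 c) (<ᵇ-false i≤l)
... | true  = begin
    completions (suc n) l i t (partialSums 0 c)
  ≡⟨ completions-suc-gaps n l i t c (<ᵇ-true i≤l) ⟩
    recurrence (λ i t c → completions n l i t (partialSums 0 c)) l i t c
  ≡⟨ recurrence-cong (λ i t c → completions≡closedFormAt n l i t c) l i t c ⟩
    recurrence (closedFormAt n l) l i t c
  ≡⟨ closedFormAt-suc n l i t c (<ᵇ-true i≤l) ⟩
    closedFormAt (suc n) l i t c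
  ≡⟨ cong (λ x → ⟦ x ⟧ * closedForm (suc n) (l ∸ i) (t ≡ᵇ 0) c) i≤l ⟩
    1 * closedForm (suc n) (l ∸ i) (t ≡ᵇ 0) c
  ∎
  where open ≡-Reasoning

-- Back to the flag f-vector

choose-factorial : ∀ a b → ((a + b) choose a) * (a ! * b !) ≡ (a + b) !
choose-factorial a b = begin
    ((a + b) choose a) * (a ! * b !)
  ≡⟨ cong₂ (λ x y → x * (a ! * y !)) (choose≡C (a + b) a) (sym (m+n∸m≡n a b)) ⟩
    ((a + b) C a) * (a ! * (a + b ∸ a) !)
  ≡⟨ cong (_* (a ! * (a + b ∸ a) !)) (nCk≡n!/k![n-k]! (m≤m+n a b)) ⟩
    ((a + b) ! / (a ! * (a + b ∸ a) !)) {{a !* (a + b ∸ a) !≢0}} * (a ! * (a + b ∸ a) !)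
  ≡⟨ m/n*n≡m {{a !* (a + b ∸ a) !≢0}} (k![n∸k]!∣n! (m≤m+n a b)) ⟩
    (a + b) !
  ∎
  where open ≡-Reasoning

sum-toList : ∀ {d} (v : Vec ℕ d) → Vec.sum v ≡ sum (toList v)
sum-toList []      = refl
sum-toList (c ∷ v) = cong (c +_) (sum-toList v)

multinomialᵥ-factorial : ∀ {d} (cs : Vec ℕ d) → multinomialᵥ cs * product (map _! (toList cs)) ≡ (Vec.sum cs) !
multinomialᵥ-factorial []       = refl
multinomialᵥ-factorial (c ∷ cs) = begin
    (((c + S) choose c) * multinomialᵥ cs) * (c ! * product (map _! (toList cs)))
  ≡⟨ regroup ((c + S) choose c) (multinomialᵥ cs) (c !) (product (map _! (toList cs))) ⟩
    ((c + S) choose c) * (c ! * (multinomialᵥ cs * product (map _! (toList cs))))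
  ≡⟨ cong (λ m → ((c + S) choose c) * (c ! * m)) (multinomialᵥ-factorial cs) ⟩
    ((c + S) choose c) * (c ! * S !)
  ≡⟨ choose-factorial c S ⟩
    (c + S) !
  ∎
  where
  open ≡-Reasoning
  S = Vec.sum cs
  regroup : ∀ x y z w → (x * y) * (z * w) ≡ x * (z * (y * w))
  regroup = solve-∀

multinomialᵥ≡multinomial : ∀ {d} (cs : Vec ℕ d) → multinomialᵥ cs ≡ multinomial (toList cs)
multinomialᵥ≡multinomial cs = sym (begin
    multinomial (toList cs)
  ≡⟨ cong (λ m → (m ! / product (map _! (toList cs))) {{prodFact≢0 (toList cs)}}) (sym (sum-toList cs)) ⟩
    ((Vec.sum cs) ! / product (map _! (toList cs))) {{prodFact≢0 (toList cs)}}
  ≡⟨ cong (λ m → (m / product (map _! (toList cs))) {{prodFact≢0 (toList cs)}}) (sym (multinomialᵥ-factorial cs)) ⟩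
    (multinomialᵥ cs * product (map _! (toList cs)) / product (map _! (toList cs))) {{prodFact≢0 (toList cs)}}
  ≡⟨ m*n/n≡m (multinomialᵥ cs) (product (map _! (toList cs))) {{prodFact≢0 (toList cs)}} ⟩
    multinomialᵥ cs
  ∎)
  where open ≡-Reasoning

∸≡ᵇ : ∀ m l r → 1 ≤ r → (m ∸ l ≡ᵇ r) ≡ (m ≡ᵇ l + r)
∸≡ᵇ m       zero    r       _ = refl
∸≡ᵇ zero    (suc l) (suc r) _ = refl
∸≡ᵇ (suc m) (suc l) r       1≤r = ∸≡ᵇ m l r 1≤r

module _ {n : ℕ} (l : ℕ) where

  rankedB : (S : List ℕ) → Vec (Tuple n l) (length S) → Bool
  rankedB []       []       = true
  rankedB (r ∷ rs) (x ∷ ch) = (isElemB x ∧ (rankR l x ≡ᵇ r)) ∧ rankedB rs ch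

  ∑-rankedSeqs : ∀ S (f : List (Tuple n l) → ℕ) →
    ∑ (rankedSeqs n l S) f ≡ ∑ (allVecs (tuples n l) (length S)) (λ ch → ⟦ rankedB S ch ⟧ * f (toList ch))
  ∑-rankedSeqs []       f = cong (_+ 0) (sym (+-identityʳ (f [])))
  ∑-rankedSeqs (r ∷ rs) f = begin
      ∑ (rankedSeqs n l (r ∷ rs)) f
    ≡⟨ ∑-pairs (filterᵇ ranked (elementsR n l)) (rankedSeqs n l rs) _∷_ f ⟩
      ∑ (filterᵇ ranked (elementsR n l)) K
    ≡⟨ trans (∑-filterᵇ ranked (elementsR n l) K) (∑-filterᵇ isElemB (tuples n l) _) ⟩
      ∑ (tuples n l) (λ x → ⟦ isElemB x ⟧ * (⟦ ranked x ⟧ * K x))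
    ≡⟨ ∑-cong (tuples n l) extend ⟩
      ∑ (tuples n l) (λ x → ∑ Chains (λ ch → ⟦ rankedB (r ∷ rs) (x ∷ ch) ⟧ * f (x ∷ toList ch)))
    ≡⟨ sym (∑-pairs (tuples n l) Chains _∷_ (λ ch → ⟦ rankedB (r ∷ rs) ch ⟧ * f (toList ch))) ⟩
      ∑ (allVecs (tuples n l) (length (r ∷ rs))) (λ ch → ⟦ rankedB (r ∷ rs) ch ⟧ * f (toList ch))
    ∎
    where
    open ≡-Reasoning
    Chains = allVecs (tuples n l) (length rs)
    ranked : Tuple n l → Bool
    ranked x = rankR l x ≡ᵇ r
    K : Tuple n l → ℕ
    K x = ∑ (rankedSeqs n l rs) (λ ch → f (x ∷ ch))
    extend : ∀ x →
      ⟦ isElemB x ⟧ * (⟦ ranked x ⟧ * K x) ≡ ∑ Chains (λ ch → ⟦ rankedB (r ∷ rs) (x ∷ ch) ⟧ * f (x ∷ toList ch))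
    extend x = begin
        ⟦ isElemB x ⟧ * (⟦ ranked x ⟧ * K x)
      ≡⟨ trans (sym (*-assoc ⟦ isElemB x ⟧ ⟦ ranked x ⟧ (K x)))
               (cong (_* K x) (sym (⟦∧⟧ (isElemB x) (ranked x)))) ⟩
        ⟦ isElemB x ∧ ranked x ⟧ * K x
      ≡⟨ cong (⟦ isElemB x ∧ ranked x ⟧ *_) (∑-rankedSeqs rs (λ ch → f (x ∷ ch))) ⟩
        ⟦ isElemB x ∧ ranked x ⟧ * ∑ Chains (λ ch → ⟦ rankedB rs ch ⟧ * f (x ∷ toList ch))
      ≡⟨ sym (∑-*ˡ Chains ⟦ isElemB x ∧ ranked x ⟧ _) ⟩
        ∑ Chains (λ ch → ⟦ isElemB x ∧ ranked x ⟧ * (⟦ rankedB rs ch ⟧ * f (x ∷ toList ch)))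
      ≡⟨ ∑-cong Chains (λ ch → trans (sym (*-assoc ⟦ isElemB x ∧ ranked x ⟧ _ _))
                                      (cong (_* f (x ∷ toList ch)) (sym (⟦∧⟧ (isElemB x ∧ ranked x) (rankedB rs ch))))) ⟩
        ∑ Chains (λ ch → ⟦ rankedB (r ∷ rs) (x ∷ ch) ⟧ * f (x ∷ toList ch))
      ∎

  increasingB-∷ : ∀ {d} x (ch : Vec (Tuple n l) d) → increasingB (x ∷ toList ch) ≡ leqNextB x ch ∧ increasingB (toList ch)
  increasingB-∷ x []      = refl
  increasingB-∷ x (y ∷ _) = refl

  rankedB-chainB : ∀ S (ch : Vec (Tuple n l) (length S)) → All (1 ≤_) S →
    rankedB S ch ∧ increasingB (toList ch) ≡ chainB 0 (length S) (Vec.map (l +_) (Vec.fromList S)) ch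
  rankedB-chainB []       []       []          = refl
  rankedB-chainB (r ∷ rs) (x ∷ ch) (1≤r ∷ pos) = begin
      ((isElemB x ∧ (rankR l x ≡ᵇ r)) ∧ rankedB rs ch) ∧ increasingB (x ∷ toList ch)
    ≡⟨ cong (((isElemB x ∧ (rankR l x ≡ᵇ r)) ∧ rankedB rs ch) ∧_) (increasingB-∷ x ch) ⟩
      ((isElemB x ∧ (rankR l x ≡ᵇ r)) ∧ rankedB rs ch) ∧ (leqNextB x ch ∧ increasingB (toList ch))
    ≡⟨ regroup (isElemB x) (rankR l x ≡ᵇ r) (rankedB rs ch) (leqNextB x ch) (increasingB (toList ch)) ⟩
      isElemB x ∧ ((rankR l x ≡ᵇ r) ∧ (leqNextB x ch ∧ (rankedB rs ch ∧ increasingB (toList ch))))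
    ≡⟨ cong₂ (λ e c → e ∧ c) (sym (completesB-isElemB x))
         (cong₂ (λ k c → k ∧ (leqNextB x ch ∧ c)) (∸≡ᵇ (size x) l r 1≤r) (rankedB-chainB rs ch pos)) ⟩
      chainB 0 (length (r ∷ rs)) (Vec.map (l +_) (Vec.fromList (r ∷ rs))) (x ∷ ch)
    ∎
    where
    open ≡-Reasoning
    regroup : ∀ e k o q i → ((e ∧ k) ∧ o) ∧ (q ∧ i) ≡ e ∧ (k ∧ (q ∧ (o ∧ i)))
    regroup = solve-∀-with ∨-∧-ring

alpha≡completions : ∀ n l S → All (1 ≤_) S → alpha n l S ≡ completions n l 0 (length S) (Vec.map (l +_) (Vec.fromList S))
alpha≡completions n l S pos = begin
    alpha n l S
  ≡⟨ length-filterᵇ increasingB (rankedSeqs n l S) ⟩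
    ∑ (rankedSeqs n l S) (λ ch → ⟦ increasingB ch ⟧)
  ≡⟨ ∑-rankedSeqs l S (λ ch → ⟦ increasingB ch ⟧) ⟩
    ∑ (allVecs (tuples n l) (length S)) (λ ch → ⟦ rankedB l S ch ⟧ * ⟦ increasingB (toList ch) ⟧)
  ≡⟨ ∑-cong (allVecs (tuples n l) (length S)) (λ ch →
       trans (sym (⟦∧⟧ (rankedB l S ch) (increasingB (toList ch)))) (cong ⟦_⟧ (rankedB-chainB l S ch pos))) ⟩
    completions n l 0 (length S) (Vec.map (l +_) (Vec.fromList S))
  ∎
  where open ≡-Reasoning

gapsᵥ : ∀ {d} → ℕ → Vec ℕ d → Vec ℕ d
gapsᵥ r []      = []
gapsᵥ r (s ∷ v) = (s ∸ r) ∷ gapsᵥ s v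

toList-gapsᵥ : ∀ r rs → toList (gapsᵥ r (Vec.fromList rs)) ≡ gaps r rs
toList-gapsᵥ r []       = refl
toList-gapsᵥ r (s ∷ ss) = cong ((s ∸ r) ∷_) (toList-gapsᵥ s ss)

partialSums-gapsᵥ : ∀ a r rs → Linked _<_ (r ∷ rs) →
  partialSums (a + r) (gapsᵥ r (Vec.fromList rs)) ≡ Vec.map (a +_) (Vec.fromList rs)
partialSums-gapsᵥ a r []       _           = refl
partialSums-gapsᵥ a r (s ∷ ss) (r<s ∷ lk) rewrite +-assoc a r (s ∸ r) | m+[n∸m]≡n (<⇒≤ r<s) =
  cong ((a + s) ∷_) (partialSums-gapsᵥ a s ss lk)

sum-gapsᵥ : ∀ r rs → Linked _<_ (r ∷ rs) → r + Vec.sum (gapsᵥ r (Vec.fromList rs)) ≡ lastOf r rs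
sum-gapsᵥ r []       _           = +-identityʳ r
sum-gapsᵥ r (s ∷ ss) (r<s ∷ lk) = begin
    r + ((s ∸ r) + Vec.sum (gapsᵥ s (Vec.fromList ss)))
  ≡⟨ sym (+-assoc r (s ∸ r) _) ⟩
    r + (s ∸ r) + Vec.sum (gapsᵥ s (Vec.fromList ss))
  ≡⟨ cong (_+ Vec.sum (gapsᵥ s (Vec.fromList ss))) (m+[n∸m]≡n (<⇒≤ r<s)) ⟩
    s + Vec.sum (gapsᵥ s (Vec.fromList ss))
  ≡⟨ sum-gapsᵥ s ss lk ⟩
    lastOf s ss
  ∎
  where open ≡-Reasoning

closedForm-gapsᵥ : ∀ n l r rs → 1 ≤ r → Linked _<_ (r ∷ rs) →
  closedForm n l false ((l + r) ∷ gapsᵥ r (Vec.fromList rs)) ≡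
    ((l + r ∸ 1) C l) * (n C (l + lastOf r rs))
      * ((2 * l + lastOf r rs) C (lastOf r rs ∸ r))
      * multinomial (gaps r rs)
closedForm-gapsᵥ n l r@(suc r′) rs _ lk = begin
    (n choose (l + r + S)) * (compositions false (l + r) l * ((l + r + S + l) choose S) * M)
  ≡⟨ cong₂ (λ N k → (n choose N) * (compositions false (l + r) l * ((N + l) choose k) * M)) l+r+S≡l+L S≡L∸r ⟩
    (n choose (l + L)) * (compositions false (l + r) l * ((l + L + l) choose (L ∸ r)) * M)
  ≡⟨ cong₂ (λ x N → (n choose (l + L)) * (x * (N choose (L ∸ r)) * M)) first-block (l+L+l≡2l+L l L) ⟩
    (n choose (l + L)) * (((l + r ∸ 1) C l) * ((2 * l + L) choose (L ∸ r)) * M)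
  ≡⟨ cong₂ (λ x y → x * (((l + r ∸ 1) C l) * y * M)) (choose≡C n (l + L)) (choose≡C (2 * l + L) (L ∸ r)) ⟩
    (n C (l + L)) * (((l + r ∸ 1) C l) * ((2 * l + L) C (L ∸ r)) * M)
  ≡⟨ cong (λ m → (n C (l + L)) * (((l + r ∸ 1) C l) * ((2 * l + L) C (L ∸ r)) * m))
          (trans (multinomialᵥ≡multinomial g) (cong multinomial (toList-gapsᵥ r rs))) ⟩
    (n C (l + L)) * (((l + r ∸ 1) C l) * ((2 * l + L) C (L ∸ r)) * multinomial (gaps r rs))
  ≡⟨ regroup (n C (l + L)) ((l + r ∸ 1) C l) ((2 * l + L) C (L ∸ r)) (multinomial (gaps r rs)) ⟩
    ((l + r ∸ 1) C l) * (n C (l + L)) * ((2 * l + L) C (L ∸ r)) * multinomial (gaps r rs)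
  ∎
  where
  open ≡-Reasoning
  g = gapsᵥ r (Vec.fromList rs)
  S = Vec.sum g
  M = multinomialᵥ g
  L = lastOf r rs
  r+S≡L : r + S ≡ L
  r+S≡L = sum-gapsᵥ r rs lk
  l+r+S≡l+L : l + r + S ≡ l + L
  l+r+S≡l+L = trans (+-assoc l r S) (cong (l +_) r+S≡L)
  S≡L∸r : S ≡ L ∸ r
  S≡L∸r = trans (sym (m+n∸m≡n r S)) (cong (_∸ r) r+S≡L)
  l+L+l≡2l+L : ∀ l L → l + L + l ≡ 2 * l + L
  l+L+l≡2l+L = solve-∀
  first-block : compositions false (l + r) l ≡ (l + r ∸ 1) C l
  first-block rewrite +-suc l r′ = choose≡C (l + r′) l
  regroup : ∀ a b c d → a * (b * c * d) ≡ b * a * c * d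
  regroup = solve-∀

positive-ranks : ∀ r rs → Linked _<_ (r ∷ rs) → 1 ≤ r → All (1 ≤_) (r ∷ rs)
positive-ranks r []       _          1≤r = 1≤r ∷ []
positive-ranks r (s ∷ ss) (r<s ∷ lk) 1≤r = 1≤r ∷ positive-ranks s ss lk (≤-trans 1≤r (<⇒≤ r<s))

proposition3p11 : (n l : ℕ) → l < n →
    (r : ℕ) (rs : List ℕ) →
    Linked _<_ (r ∷ rs) → 1 ≤ r → All (λ s → s ≤ n ∸ l) (r ∷ rs) →
    alpha n l (r ∷ rs) ≡
      ((l + r ∸ 1) C l) * (n C (l + lastOf r rs))
        * ((2 * l + lastOf r rs) C (lastOf r rs ∸ r))
        * multinomial (gaps r rs)
proposition3p11 n l _ r rs sorted 1≤r _ = begin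
    alpha n l (r ∷ rs)
  ≡⟨ alpha≡completions n l (r ∷ rs) (positive-ranks r rs sorted 1≤r) ⟩
    completions n l 0 (length (r ∷ rs)) ((l + r) ∷ Vec.map (l +_) (Vec.fromList rs))
  ≡⟨ cong (λ us → completions n l 0 (length (r ∷ rs)) ((l + r) ∷ us)) (sym (partialSums-gapsᵥ l r rs sorted)) ⟩
    completions n l 0 (length (r ∷ rs)) (partialSums 0 ((l + r) ∷ gapsᵥ r (Vec.fromList rs)))
  ≡⟨ completions≡closedFormAt n l 0 (length (r ∷ rs)) ((l + r) ∷ gapsᵥ r (Vec.fromList rs)) ⟩
    1 * closedForm n l false ((l + r) ∷ gapsᵥ r (Vec.fromList rs))
  ≡⟨ *-identityˡ _ ⟩
    closedForm n l false ((l + r) ∷ gapsᵥ r (Vec.fromList rs))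
  ≡⟨ closedForm-gapsᵥ n l r rs 1≤r sorted ⟩
    ((l + r ∸ 1) C l) * (n C (l + lastOf r rs)) * ((2 * l + lastOf r rs) C (lastOf r rs ∸ r)) * multinomial (gaps r rs)
  ∎
  where open ≡-Reasoning
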